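{- Let $P$ be a near-Eulerian poset. Then $\Upsilon^\ell_P=\Upsilon_P-\Upsilon_{P_1(\partial P)}$.
   Context: For a graded poset $P$ of rank $m+1$ with $\hat0,\hat1$, $\alpha_P(S)$ ($S\subseteq[m]$) is the number of maximal chains of $\{x\in P:\rho(x)\in S\}$; the flag polynomial is $\Upsilon_P=\sum_S\alpha_P(S)u_S$ and the ab-index is $\Psi_P(a,b)=\Upsilon_P(a-b,b)$, where $u_S$ is the word in noncommuting $a,b$ with $b$ in positions of $S$ and $a$ elsewhere. A poset is Eulerian if it is graded with $\hat0,\hat1$ and every interval $[s,t]$, $s<t$, has equally many elements of even and odd rank. $P$ is near-Eulerian if $P=Q\setminus\{x\}$ for an Eulerian $Q$ and a coatom $x$ of $Q$; $Q=:\widetilde\Sigma P$ is uniquely determined; the boundary $\partial P$ is $[\hat0,x)_Q$ with a new maximum adjoined. For a poset $R$, $P_1(R)$ is $R$ with a new maximum adjoined. The local ab-index is $\Psi^\ell_P=\Psi_{\widetilde\Sigma P}-\Psi_{\partial P}\cdot(a+b)$, and the local flag polynomial is $\Upsilon^\ell_P(a,b):=\Psi^\ell_P(a+b,b)$. -}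

module Defs where

open import Data.Bool using (Bool; true; false; _∧_; _∨_; not; if_then_else_)
open import Data.Nat using (ℕ; zero; suc; _∸_; _≤ᵇ_)
open import Data.Integer using (ℤ; +_; -_) renaming (_+_ to _+ℤ_; _*_ to _*ℤ_)
open import Data.Fin using (Fin; _≟_)
open import Data.List using (List; []; _∷_; _++_; map; concatMap; length; filterᵇ; allFin; foldr)
open import Data.Bool.ListAction using (all; any)
open import Data.Product using (_×_; _,_; ∃-syntax; Σ)
open import Data.Maybe using (Maybe; just; nothing)
open import Relation.Binary.PropositionalEquality using (_≡_)
open import Relation.Nullary using (¬_; does)

-- A word is a list of letters: false = a, true = b.
-- A polynomial is a finite formal sum (list of terms); two polynomials
-- are equal iff all their coefficients agree (see coeff).

Word : Set
Word = List Bool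

_==w_ : Word → Word → Bool
[] ==w [] = true
(x ∷ xs) ==w (y ∷ ys) = ((x ∧ y) ∨ (not x ∧ not y)) ∧ (xs ==w ys)
_ ==w _ = false

NCPoly : Set
NCPoly = List (ℤ × Word)

coeff : NCPoly → Word → ℤ
coeff [] w = + 0
coeff ((c , v) ∷ p) w = (if v ==w w then c else + 0) +ℤ coeff p w

_⊕_ : NCPoly → NCPoly → NCPoly
p ⊕ q = p ++ q

scale : ℤ → NCPoly → NCPoly
scale c p = map (λ { (d , v) → (c *ℤ d , v) }) p

_⊖_ : NCPoly → NCPoly → NCPoly
p ⊖ q = p ++ scale (- (+ 1)) q

_⊗_ : NCPoly → NCPoly → NCPoly
p ⊗ q = concatMap (λ { (c , v) → map (λ { (d , u) → (c *ℤ d , v ++ u) }) q }) p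

one : NCPoly
one = (+ 1 , []) ∷ []

varA varB : NCPoly
varA = (+ 1 , false ∷ []) ∷ []
varB = (+ 1 , true ∷ []) ∷ []

substWord : (Bool → NCPoly) → Word → NCPoly
substWord σ = foldr (λ l acc → σ l ⊗ acc) one

subst : (Bool → NCPoly) → NCPoly → NCPoly
subst σ = concatMap (λ { (c , w) → scale c (substWord σ w) })

σ⁻ : Bool → NCPoly
σ⁻ false = varA ⊖ varB
σ⁻ true  = varB

σ⁺ : Bool → NCPoly
σ⁺ false = varA ⊕ varB
σ⁺ true  = varB

-- Raw ranked finite posets: the data needed to compute flag polynomials.
-- elems lists the (distinct) elements, le is the order, rk the rank
-- function and height the rank m+1 of the poset (rank of its maximum).

record RawRanked : Set₁ where
  field
    A      : Set
    elems  : List A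
    le     : A → A → Bool
    rk     : A → ℕ
    height : ℕ
open RawRanked public

allMasks : ℕ → List (List Bool)
allMasks zero = [] ∷ []
allMasks (suc k) = map (false ∷_) (allMasks k) ++ map (true ∷_) (allMasks k)

module _ {A : Set} where
  selT selF : List A → List Bool → List A
  selT [] _ = []
  selT (x ∷ xs) [] = []
  selT (x ∷ xs) (true ∷ ms) = x ∷ selT xs ms
  selT (x ∷ xs) (false ∷ ms) = selT xs ms
  selF [] _ = []
  selF (x ∷ xs) [] = x ∷ xs
  selF (x ∷ xs) (true ∷ ms) = selF xs ms
  selF (x ∷ xs) (false ∷ ms) = x ∷ selF xs ms

  comparable : (A → A → Bool) → A → A → Bool
  comparable le x y = le x y ∨ le y x

  isChain : (A → A → Bool) → List A → Bool
  isChain le [] = true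
  isChain le (x ∷ xs) = all (comparable le x) xs ∧ isChain le xs

  isMaxChain : (A → A → Bool) → List A → List Bool → Bool
  isMaxChain le R m =
    isChain le (selT R m) ∧
    all (λ y → any (λ c → not (comparable le y c)) (selT R m)) (selF R m)

  #maxChains : (A → A → Bool) → List A → ℕ
  #maxChains le R = length (filterᵇ (isMaxChain le R) (allMasks (length R)))

-- S ⊆ [m] encoded as a mask of length m; position i (0-based) is rank i+1
inS : ℕ → List Bool → Bool
inS zero S = false
inS (suc r) [] = false
inS (suc zero) (s ∷ S) = s
inS (suc (suc r)) (s ∷ S) = inS (suc r) S

α : (R : RawRanked) → List Bool → ℕ
α R S = #maxChains (le R) (filterᵇ (λ y → inS (rk R y) S) (elems R))

Υ : RawRanked → NCPoly
Υ R = map (λ S → (+ α R S , S)) (allMasks (height R ∸ 1))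

Ψ : RawRanked → NCPoly
Ψ R = subst σ⁻ (Υ R)

adjoinTop : RawRanked → ℕ → RawRanked
adjoinTop R h = record
  { A = Maybe (A R)
  ; elems = nothing ∷ map just (elems R)
  ; le = λ { (just x) (just y) → le R x y ; _ nothing → true ; nothing (just _) → false }
  ; rk = λ { (just x) → rk R x ; nothing → h }
  ; height = h }

P₁ : RawRanked → RawRanked
P₁ R = adjoinTop R (suc (height R))

record BoundedPoset : Set where
  field
    n       : ℕ
    _≤ᵖ_    : Fin n → Fin n → Bool
    reflᵖ   : ∀ x → (x ≤ᵖ x) ≡ true
    antisymᵖ : ∀ x y → (x ≤ᵖ y) ≡ true → (y ≤ᵖ x) ≡ true → x ≡ y
    transᵖ  : ∀ x y z → (x ≤ᵖ y) ≡ true → (y ≤ᵖ z) ≡ true → (x ≤ᵖ z) ≡ true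
    𝟘 𝟙     : Fin n
    𝟘-min   : ∀ x → (𝟘 ≤ᵖ x) ≡ true
    𝟙-max   : ∀ x → (x ≤ᵖ 𝟙) ≡ true
open BoundedPoset public

module _ (P : BoundedPoset) where
  private module P = BoundedPoset P

  _<ᵖ_ : Fin P.n → Fin P.n → Bool
  x <ᵖ y = (x P.≤ᵖ y) ∧ not (does (x ≟ y))

  _⋖_ : Fin P.n → Fin P.n → Set
  x ⋖ y = ((x <ᵖ y) ≡ true) × ¬ (∃[ z ] (((x <ᵖ z) ≡ true) × ((z <ᵖ y) ≡ true)))

  IsRankFunction : (Fin P.n → ℕ) → Set
  IsRankFunction ρ = (ρ P.𝟘 ≡ 0) × (∀ x y → x ⋖ y → ρ y ≡ suc (ρ x))

  isEven : ℕ → Bool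
  isEven zero = true
  isEven (suc k) = not (isEven k)

  IsEulerian : (Fin P.n → ℕ) → Set
  IsEulerian ρ = ∀ s t → (s <ᵖ t) ≡ true →
    length (filterᵇ (λ z → (s P.≤ᵖ z) ∧ (z P.≤ᵖ t) ∧ isEven (ρ z)) (allFin P.n))
    ≡ length (filterᵇ (λ z → (s P.≤ᵖ z) ∧ (z P.≤ᵖ t) ∧ not (isEven (ρ z))) (allFin P.n))

  IsCoatom : Fin P.n → Set
  IsCoatom x = x ⋖ P.𝟙

  toRaw : (Fin P.n → ℕ) → RawRanked
  toRaw ρ = record { A = Fin P.n ; elems = allFin P.n ; le = P._≤ᵖ_ ; rk = ρ ; height = ρ P.𝟙 }

  -- the near-Eulerian poset P = Q ∖ {x}
  removeElem : (Fin P.n → ℕ) → Fin P.n → RawRanked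
  removeElem ρ x = record
    { A = Fin P.n
    ; elems = filterᵇ (λ y → not (does (y ≟ x))) (allFin P.n)
    ; le = P._≤ᵖ_ ; rk = ρ ; height = ρ P.𝟙 }

  below : (Fin P.n → ℕ) → Fin P.n → RawRanked
  below ρ x = record
    { A = Fin P.n
    ; elems = filterᵇ (λ y → y <ᵖ x) (allFin P.n)
    ; le = P._≤ᵖ_ ; rk = ρ ; height = ρ x }

  boundary : (Fin P.n → ℕ) → Fin P.n → RawRanked
  boundary ρ x = adjoinTop (below ρ x) (ρ x)

  -- local ab-index Ψ^ℓ_P = Ψ_{Σ̃P} - Ψ_{∂P}·(a+b), with Σ̃P = Q
  Ψℓ : (Fin P.n → ℕ) → Fin P.n → NCPoly
  Ψℓ ρ x = Ψ (toRaw ρ) ⊖ (Ψ (boundary ρ x) ⊗ (varA ⊕ varB))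

  Υℓ : (Fin P.n → ℕ) → Fin P.n → NCPoly
  Υℓ ρ x = subst σ⁺ (Ψℓ ρ x)

-- Since (a,b) ↦ (a+b,b) inverts (a,b) ↦ (a−b,b) and sends a+b to a+2b, the local flag polynomial
-- is Υ_Q − Υ_∂P·(a+2b), where Q = Σ̃P.  Writing S ⊆ [ρ(x)] as u ⊆ [ρ(x)−1] plus possibly ρ(x), comparing
-- coefficients reduces the theorem to three counts of maximal chains of rank-selected subposets:
-- (1) if ρ(x) ∉ S, then Q_S = P_S;
-- (2) P₁(∂P) and ∂P have as many S-selected maximal chains as [0̂,x) has u-selected ones, because an
--     adjoined top is either not selected or lies on every maximal chain;
-- (3) if ρ(x) ∈ S, the maximal chains of Q_S through x are those of [0̂,x)_u extended by x, and the
--     others are exactly the maximal chains of P_S.  For the latter, every maximal chain of P_S has an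
--     element incomparable to x: otherwise it lies below x, and the Eulerian diamond property gives an
--     element z ≠ x of rank ρ(x) above its top, which the chain could neither contain nor exclude.

module Submission where

open import Defs
open import Data.Bool using (Bool; true; false; _∧_; _∨_; not; if_then_else_; T?)
open import Data.Bool.Properties using (∧-comm; ∧-zeroʳ; not-involutive)
open import Data.Bool.ListAction using (all; any)
open import Data.Nat using (ℕ; zero; suc; _∸_; _≤_; _<_; z≤n; s≤s)
import Data.Nat as ℕ
open import Data.Nat.Properties using (≤-trans; <-trans; <-irrefl; ≤-refl; m≤n⇒m≤1+n; ≤-pred; ≤-antisym; ≤-reflexive; n<1+n)
open import Data.Fin using (Fin; _≟_)
open import Data.List using (List; []; _∷_; _++_; _∷ʳ_; map; length; filterᵇ; allFin)
open import Data.List.Properties using (length-map; ++-assoc; map-++; map-∘)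
open import Data.List.Membership.Propositional using (_∈_)
open import Data.List.Membership.Propositional.Properties using (∈-allFin)
open import Data.List.Relation.Unary.Any using (here; there)
open import Data.List.Relation.Unary.All using (All; []; _∷_) renaming (lookup to All-lookup)
open import Data.List.Relation.Unary.AllPairs using ([]; _∷_)
open import Data.List.Relation.Unary.Unique.Propositional using (Unique)
open import Data.List.Relation.Unary.Unique.Propositional.Properties using (allFin⁺; filter⁺)
open import Data.List.Relation.Binary.Subset.Propositional using (_⊆_)
open import Data.List.Relation.Binary.Subset.Propositional.Properties using (⊆-refl; ∷⁺ʳ)
open import Data.Maybe using (just; nothing)
open import Data.Product using (_×_; _,_; Σ; proj₁; proj₂; map₁)
open import Data.Sum using (_⊎_; inj₁; inj₂)
import Data.Sum as Sum
open import Data.Empty using (⊥; ⊥-elim)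
open import Function using (id; _∘_; case_of_)
open import Relation.Nullary using (¬_; yes; no; does)
open import Relation.Nullary.Decidable using (dec-true; dec-false)
open import Relation.Binary.Definitions using (DecidableEquality)
open import Relation.Binary.PropositionalEquality
  using (_≡_; _≢_; _≗_; refl; sym; trans; cong; cong₂; module ≡-Reasoning) renaming (subst to ≡-subst; subst₂ to ≡-subst₂)

true≢false : ¬ true ≡ false
true≢false ()

∧-true⁻ : ∀ a {b} → a ∧ b ≡ true → (a ≡ true) × (b ≡ true)
∧-true⁻ true {true} _ = refl , refl

∧-true⁺ : ∀ {a b} → a ≡ true → b ≡ true → a ∧ b ≡ true
∧-true⁺ refl refl = refl

∨-true⁻ : ∀ a {b} → a ∨ b ≡ true → (a ≡ true) ⊎ (b ≡ true)
∨-true⁻ true _ = inj₁ refl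
∨-true⁻ false e = inj₂ e

∨-trueˡ : ∀ {a} b → a ≡ true → a ∨ b ≡ true
∨-trueˡ _ refl = refl

∨-trueʳ : ∀ a {b} → b ≡ true → a ∨ b ≡ true
∨-trueʳ true _ = refl
∨-trueʳ false e = e

not-true : ∀ {a} → not a ≡ true → a ≡ false
not-true {false} _ = refl

true-if : ∀ {a} → ¬ (a ≡ false) → a ≡ true
true-if {true} _ = refl
true-if {false} h = ⊥-elim (h refl)

false-if : ∀ {a} → ¬ (a ≡ true) → a ≡ false
false-if {false} _ = refl
false-if {true} h = ⊥-elim (h refl)

bool-ext : ∀ {a b} → (a ≡ true → b ≡ true) → (b ≡ true → a ≡ true) → a ≡ b
bool-ext {true} {true} _ _ = refl
bool-ext {false} {false} _ _ = refl
bool-ext {true} {false} f _ = sym (f refl)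
bool-ext {false} {true} _ g = g refl

all⁻ : ∀ {X : Set} (f : X → Bool) xs → all f xs ≡ true → ∀ {a} → a ∈ xs → f a ≡ true
all⁻ f (x ∷ xs) e (here refl) = proj₁ (∧-true⁻ (f x) e)
all⁻ f (x ∷ xs) e (there i) = all⁻ f xs (proj₂ (∧-true⁻ (f x) e)) i

all⁺ : ∀ {X : Set} (f : X → Bool) xs → (∀ {a} → a ∈ xs → f a ≡ true) → all f xs ≡ true
all⁺ f [] h = refl
all⁺ f (x ∷ xs) h = ∧-true⁺ (h (here refl)) (all⁺ f xs (λ i → h (there i)))

any⁻ : ∀ {X : Set} (f : X → Bool) xs → any f xs ≡ true → Σ X λ a → (a ∈ xs) × (f a ≡ true)
any⁻ f (x ∷ xs) e with ∨-true⁻ (f x) e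
... | inj₁ fx = x , here refl , fx
... | inj₂ rest with any⁻ f xs rest
... | a , i , fa = a , there i , fa

any⁺ : ∀ {X : Set} (f : X → Bool) xs {a} → a ∈ xs → f a ≡ true → any f xs ≡ true
any⁺ f (x ∷ xs) (here refl) fa = ∨-trueˡ _ fa
any⁺ f (x ∷ xs) (there i) fa = ∨-trueʳ (f x) (any⁺ f xs i fa)

module _ {X : Set} where

  length-filterᵇ-++ : ∀ (f : X → Bool) xs ys →
    length (filterᵇ f (xs ++ ys)) ≡ length (filterᵇ f xs) ℕ.+ length (filterᵇ f ys)
  length-filterᵇ-++ f [] ys = refl
  length-filterᵇ-++ f (x ∷ xs) ys with f x
  ... | true = cong suc (length-filterᵇ-++ f xs ys)
  ... | false = length-filterᵇ-++ f xs ys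

  filterᵇ-map : ∀ {Y : Set} (f : Y → Bool) (g : X → Y) xs → filterᵇ f (map g xs) ≡ map g (filterᵇ (λ a → f (g a)) xs)
  filterᵇ-map f g [] = refl
  filterᵇ-map f g (x ∷ xs) with f (g x)
  ... | true = cong (g x ∷_) (filterᵇ-map f g xs)
  ... | false = filterᵇ-map f g xs

  filterᵇ-accept : ∀ (f : X → Bool) {x} xs → f x ≡ true → filterᵇ f (x ∷ xs) ≡ x ∷ filterᵇ f xs
  filterᵇ-accept f xs fx rewrite fx = refl

  filterᵇ-reject : ∀ (f : X → Bool) {x} xs → f x ≡ false → filterᵇ f (x ∷ xs) ≡ filterᵇ f xs
  filterᵇ-reject f xs fx rewrite fx = refl

  filterᵇ-filterᵇ : ∀ (f g : X → Bool) xs → filterᵇ f (filterᵇ g xs) ≡ filterᵇ (λ a → g a ∧ f a) xs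
  filterᵇ-filterᵇ f g [] = refl
  filterᵇ-filterᵇ f g (x ∷ xs) with g x
  ... | false = filterᵇ-filterᵇ f g xs
  ... | true with f x
  ...   | true = cong (x ∷_) (filterᵇ-filterᵇ f g xs)
  ...   | false = filterᵇ-filterᵇ f g xs

  filterᵇ-cong : ∀ {f g : X → Bool} xs → (∀ {a} → a ∈ xs → f a ≡ g a) → filterᵇ f xs ≡ filterᵇ g xs
  filterᵇ-cong [] _ = refl
  filterᵇ-cong {f} {g} (x ∷ xs) f≡g with f x | g x | f≡g (here refl)
  ... | true | true | _ = cong (x ∷_) (filterᵇ-cong xs (λ i → f≡g (there i)))
  ... | false | false | _ = filterᵇ-cong xs (λ i → f≡g (there i))

  filterᵇ-comm : ∀ (f g : X → Bool) xs → filterᵇ f (filterᵇ g xs) ≡ filterᵇ g (filterᵇ f xs)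
  filterᵇ-comm f g xs = trans (filterᵇ-filterᵇ f g xs)
    (trans (filterᵇ-cong xs (λ {a} _ → ∧-comm (g a) (f a))) (sym (filterᵇ-filterᵇ g f xs)))

  ∈-filterᵇ⁻ : ∀ (f : X → Bool) xs {a} → a ∈ filterᵇ f xs → (a ∈ xs) × (f a ≡ true)
  ∈-filterᵇ⁻ f (x ∷ xs) i with f x in fx
  ∈-filterᵇ⁻ f (x ∷ xs) (here refl) | true = here refl , fx
  ∈-filterᵇ⁻ f (x ∷ xs) (there i) | true = map₁ there (∈-filterᵇ⁻ f xs i)
  ∈-filterᵇ⁻ f (x ∷ xs) i | false = map₁ there (∈-filterᵇ⁻ f xs i)

  ∈-filterᵇ⁺ : ∀ (f : X → Bool) xs {a} → a ∈ xs → f a ≡ true → a ∈ filterᵇ f xs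
  ∈-filterᵇ⁺ f (x ∷ xs) (here refl) fa rewrite fa = here refl
  ∈-filterᵇ⁺ f (x ∷ xs) (there i) fa with f x
  ... | true = there (∈-filterᵇ⁺ f xs i fa)
  ... | false = ∈-filterᵇ⁺ f xs i fa

  length-filterᵇ-mono : ∀ {f g : X → Bool} L → (∀ a → f a ≡ true → g a ≡ true) → length (filterᵇ f L) ≤ length (filterᵇ g L)
  length-filterᵇ-mono [] f⇒g = z≤n
  length-filterᵇ-mono {f} {g} (a ∷ L) f⇒g with f a in fa | g a in ga
  ... | true | true = s≤s (length-filterᵇ-mono L f⇒g)
  ... | false | true = m≤n⇒m≤1+n (length-filterᵇ-mono L f⇒g)
  ... | false | false = length-filterᵇ-mono L f⇒g
  ... | true | false with () ← trans (sym ga) (f⇒g a fa)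

  length-filterᵇ-< : ∀ {f g : X → Bool} L → (∀ a → f a ≡ true → g a ≡ true) →
    ∀ {c} → c ∈ L → g c ≡ true → f c ≡ false → length (filterᵇ f L) < length (filterᵇ g L)
  length-filterᵇ-< (a ∷ L) f⇒g (here refl) gc fc rewrite gc | fc = s≤s (length-filterᵇ-mono L f⇒g)
  length-filterᵇ-< {f} {g} (a ∷ L) f⇒g (there c∈L) gc fc with f a in fa | g a in ga
  ... | true | true = s≤s (length-filterᵇ-< L f⇒g c∈L gc fc)
  ... | false | true = m≤n⇒m≤1+n (length-filterᵇ-< L f⇒g c∈L gc fc)
  ... | false | false = length-filterᵇ-< L f⇒g c∈L gc fc
  ... | true | false with () ← trans (sym ga) (f⇒g a fa)

  length-filterᵇ-≥1 : ∀ (f : X → Bool) L {a} → a ∈ L → f a ≡ true → 1 ≤ length (filterᵇ f L)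
  length-filterᵇ-≥1 f (b ∷ L) (here refl) fa rewrite fa = s≤s z≤n
  length-filterᵇ-≥1 f (b ∷ L) (there a∈L) fa with f b
  ... | true = s≤s z≤n
  ... | false = length-filterᵇ-≥1 f L a∈L fa

  length-filterᵇ-≥2 : ∀ (f : X → Bool) L {a b} → a ∈ L → b ∈ L → a ≢ b → f a ≡ true → f b ≡ true →
    2 ≤ length (filterᵇ f L)
  length-filterᵇ-≥2 f (c ∷ L) (here refl) (here refl) a≢b _ _ = ⊥-elim (a≢b refl)
  length-filterᵇ-≥2 f (c ∷ L) (here refl) (there b∈L) _ fa fb rewrite fa = s≤s (length-filterᵇ-≥1 f L b∈L fb)
  length-filterᵇ-≥2 f (c ∷ L) (there a∈L) (here refl) _ fa fb rewrite fb = s≤s (length-filterᵇ-≥1 f L a∈L fa)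
  length-filterᵇ-≥2 f (c ∷ L) (there a∈L) (there b∈L) a≢b fa fb with f c
  ... | true = s≤s (length-filterᵇ-≥1 f L a∈L fa)
  ... | false = length-filterᵇ-≥2 f L a∈L b∈L a≢b fa fb

  filterᵇ-none : ∀ (f : X → Bool) L → (∀ {b} → b ∈ L → f b ≡ false) → filterᵇ f L ≡ []
  filterᵇ-none f [] _ = refl
  filterᵇ-none f (b ∷ L) none rewrite none (here refl) = filterᵇ-none f L (none ∘ there)

  length-filterᵇ-≤1 : ∀ (f : X → Bool) {L} x → Unique L → (∀ z → f z ≡ true → z ≡ x) → length (filterᵇ f L) ≤ 1
  length-filterᵇ-≤1 f x [] _ = z≤n
  length-filterᵇ-≤1 f {a ∷ L} x (a∉L ∷ unique) only-x with f a in fa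
  ... | false = length-filterᵇ-≤1 f x unique only-x
  ... | true rewrite filterᵇ-none f L (λ b∈L → false-if λ fb →
                       All-lookup a∉L b∈L (trans (only-x a fa) (sym (only-x _ fb)))) = s≤s z≤n

-- Polynomials are lists of terms, so equal polynomials need not be equal lists; all algebra is done
-- on the pairing ⟪ p ∣ f ⟫ of p with functions f on words, which coefficient extraction factors through.
module Pairing where
  open import Data.Integer using (ℤ; +_; -_; _+_; _-_; _*_)
  open import Data.Integer.Properties using (pos-+; +-identityˡ; +-identityʳ; *-identityʳ; *-zeroʳ)
  open import Data.Integer.Tactic.RingSolver using (solve-∀)

  ⟪_∣_⟫ : NCPoly → (Word → ℤ) → ℤ
  ⟪ [] ∣ f ⟫ = + 0
  ⟪ (c , v) ∷ p ∣ f ⟫ = c * f v + ⟪ p ∣ f ⟫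

  pair-cong : ∀ p {f g} → f ≗ g → ⟪ p ∣ f ⟫ ≡ ⟪ p ∣ g ⟫
  pair-cong [] f≗g = refl
  pair-cong ((c , v) ∷ p) f≗g = cong₂ (λ a b → c * a + b) (f≗g v) (pair-cong p f≗g)

  pair-++ : ∀ p q f → ⟪ p ++ q ∣ f ⟫ ≡ ⟪ p ∣ f ⟫ + ⟪ q ∣ f ⟫
  pair-++ [] q f = sym (+-identityˡ _)
  pair-++ ((c , v) ∷ p) q f = trans (cong (_+_ (c * f v)) (pair-++ p q f)) (lemma (c * f v) _ _)
    where
    lemma : ∀ a b d → a + (b + d) ≡ (a + b) + d
    lemma = solve-∀

  pair-scale : ∀ k p f → ⟪ scale k p ∣ f ⟫ ≡ k * ⟪ p ∣ f ⟫
  pair-scale k [] f = sym (*-zeroʳ k)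
  pair-scale k ((c , v) ∷ p) f = trans (cong (_+_ (k * c * f v)) (pair-scale k p f)) (lemma k c (f v) _)
    where
    lemma : ∀ k c a b → k * c * a + k * b ≡ k * (c * a + b)
    lemma = solve-∀

  pair-⊖ : ∀ p q f → ⟪ p ⊖ q ∣ f ⟫ ≡ ⟪ p ∣ f ⟫ - ⟪ q ∣ f ⟫
  pair-⊖ p q f = trans (pair-++ p (scale (- + 1) q) f) (cong (_+_ ⟪ p ∣ f ⟫) (trans (pair-scale (- + 1) q f) (lemma _)))
    where
    lemma : ∀ a → - + 1 * a ≡ - a
    lemma = solve-∀

  pair-zero : ∀ p → ⟪ p ∣ (λ _ → + 0) ⟫ ≡ + 0
  pair-zero [] = refl
  pair-zero ((c , v) ∷ p) = trans (cong (_+_ (c * + 0)) (pair-zero p)) (trans (+-identityʳ _) (*-zeroʳ c))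

  pair-+ : ∀ p f g → ⟪ p ∣ (λ v → f v + g v) ⟫ ≡ ⟪ p ∣ f ⟫ + ⟪ p ∣ g ⟫
  pair-+ [] f g = refl
  pair-+ ((c , v) ∷ p) f g = trans (cong (_+_ (c * (f v + g v))) (pair-+ p f g)) (lemma c (f v) (g v) _ _)
    where
    lemma : ∀ c a b s t → c * (a + b) + (s + t) ≡ (c * a + s) + (c * b + t)
    lemma = solve-∀

  pair-*ˡ : ∀ p k f → ⟪ p ∣ (λ v → k * f v) ⟫ ≡ k * ⟪ p ∣ f ⟫
  pair-*ˡ [] k f = sym (*-zeroʳ k)
  pair-*ˡ ((c , v) ∷ p) k f = trans (cong (_+_ (c * (k * f v))) (pair-*ˡ p k f)) (lemma c k (f v) _)
    where
    lemma : ∀ c k a s → c * (k * a) + k * s ≡ k * (c * a + s)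
    lemma = solve-∀

  pair-swap : ∀ p q (F : Word → Word → ℤ) →
    ⟪ p ∣ (λ v → ⟪ q ∣ F v ⟫) ⟫ ≡ ⟪ q ∣ (λ u → ⟪ p ∣ (λ v → F v u) ⟫) ⟫
  pair-swap [] q F = sym (pair-zero q)
  pair-swap ((c , v) ∷ p) q F = begin
    c * ⟪ q ∣ F v ⟫ + ⟪ p ∣ (λ v → ⟪ q ∣ F v ⟫) ⟫
      ≡⟨ cong₂ _+_ (sym (pair-*ˡ q c (F v))) (pair-swap p q F) ⟩
    ⟪ q ∣ (λ u → c * F v u) ⟫ + ⟪ q ∣ (λ u → ⟪ p ∣ (λ v → F v u) ⟫) ⟫
      ≡⟨ sym (pair-+ q _ _) ⟩
    ⟪ q ∣ (λ u → c * F v u + ⟪ p ∣ (λ v → F v u) ⟫) ⟫ ∎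
    where open ≡-Reasoning

  pair-⊗ : ∀ p q f → ⟪ p ⊗ q ∣ f ⟫ ≡ ⟪ p ∣ (λ v → ⟪ q ∣ (λ u → f (v ++ u)) ⟫) ⟫
  pair-⊗ [] q f = refl
  pair-⊗ ((c , v) ∷ p) q f = trans (pair-++ (map _ q) (p ⊗ q) f) (cong₂ _+_ (left q) (pair-⊗ p q f))
    where
    left : ∀ q → ⟪ map (λ { (d , u) → (c * d , v ++ u) }) q ∣ f ⟫ ≡ c * ⟪ q ∣ (λ u → f (v ++ u)) ⟫
    left [] = sym (*-zeroʳ c)
    left ((d , u) ∷ q) = trans (cong (_+_ (c * d * f (v ++ u))) (left q)) (lemma c d (f (v ++ u)) _)
      where
      lemma : ∀ c d a s → c * d * a + c * s ≡ c * (d * a + s)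
      lemma = solve-∀

  pair-one : ∀ f → ⟪ one ∣ f ⟫ ≡ f []
  pair-one f = lemma (f [])
    where
    lemma : ∀ a → + 1 * a + + 0 ≡ a
    lemma = solve-∀

  pair-subst : ∀ σ p f → ⟪ subst σ p ∣ f ⟫ ≡ ⟪ p ∣ (λ v → ⟪ substWord σ v ∣ f ⟫) ⟫
  pair-subst σ [] f = refl
  pair-subst σ ((c , v) ∷ p) f = trans (pair-++ (scale c (substWord σ v)) (subst σ p) f)
    (cong₂ _+_ (pair-scale c (substWord σ v) f) (pair-subst σ p f))

  pair-substWord-++ : ∀ σ v u f →
    ⟪ substWord σ (v ++ u) ∣ f ⟫ ≡ ⟪ substWord σ v ∣ (λ m → ⟪ substWord σ u ∣ (λ m′ → f (m ++ m′)) ⟫) ⟫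
  pair-substWord-++ σ [] u f = sym (pair-one (λ m → ⟪ substWord σ u ∣ (λ m′ → f (m ++ m′)) ⟫))
  pair-substWord-++ σ (l ∷ v) u f = begin
    ⟪ σ l ⊗ substWord σ (v ++ u) ∣ f ⟫
      ≡⟨ pair-⊗ (σ l) _ f ⟩
    ⟪ σ l ∣ (λ m → ⟪ substWord σ (v ++ u) ∣ (λ m₁ → f (m ++ m₁)) ⟫) ⟫
      ≡⟨ pair-cong (σ l) (λ m → pair-substWord-++ σ v u (λ m₁ → f (m ++ m₁))) ⟩
    ⟪ σ l ∣ (λ m → ⟪ substWord σ v ∣ (λ m₁ → ⟪ substWord σ u ∣ (λ m′ → f (m ++ (m₁ ++ m′))) ⟫) ⟫) ⟫
      ≡⟨ pair-cong (σ l) (λ m → pair-cong (substWord σ v) (λ m₁ → pair-cong (substWord σ u) (λ m′ →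
           cong f (sym (++-assoc m m₁ m′))))) ⟩
    ⟪ σ l ∣ (λ m → ⟪ substWord σ v ∣ (λ m₁ → ⟪ substWord σ u ∣ (λ m′ → f ((m ++ m₁) ++ m′)) ⟫) ⟫) ⟫
      ≡⟨ sym (pair-⊗ (σ l) (substWord σ v) _) ⟩
    ⟪ σ l ⊗ substWord σ v ∣ (λ m → ⟪ substWord σ u ∣ (λ m′ → f (m ++ m′)) ⟫) ⟫ ∎
    where open ≡-Reasoning

  pair-subst-⊗ : ∀ σ p q f →
    ⟪ subst σ (p ⊗ q) ∣ f ⟫ ≡ ⟪ subst σ p ∣ (λ v → ⟪ subst σ q ∣ (λ u → f (v ++ u)) ⟫) ⟫
  pair-subst-⊗ σ p q f = begin
    ⟪ subst σ (p ⊗ q) ∣ f ⟫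
      ≡⟨ pair-subst σ (p ⊗ q) f ⟩
    ⟪ p ⊗ q ∣ (λ w → ⟪ substWord σ w ∣ f ⟫) ⟫
      ≡⟨ pair-⊗ p q _ ⟩
    ⟪ p ∣ (λ v → ⟪ q ∣ (λ u → ⟪ substWord σ (v ++ u) ∣ f ⟫) ⟫) ⟫
      ≡⟨ pair-cong p (λ v → pair-cong q (λ u → pair-substWord-++ σ v u f)) ⟩
    ⟪ p ∣ (λ v → ⟪ q ∣ (λ u → ⟪ substWord σ v ∣ (λ m → ⟪ substWord σ u ∣ (λ m′ → f (m ++ m′)) ⟫) ⟫) ⟫) ⟫
      ≡⟨ pair-cong p (λ v → pair-swap q (substWord σ v) _) ⟩
    ⟪ p ∣ (λ v → ⟪ substWord σ v ∣ (λ m → ⟪ q ∣ (λ u → ⟪ substWord σ u ∣ (λ m′ → f (m ++ m′)) ⟫) ⟫) ⟫) ⟫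
      ≡⟨ pair-cong p (λ v → pair-cong (substWord σ v) (λ m → sym (pair-subst σ q _))) ⟩
    ⟪ p ∣ (λ v → ⟪ substWord σ v ∣ (λ m → ⟪ subst σ q ∣ (λ u → f (m ++ u)) ⟫) ⟫) ⟫
      ≡⟨ sym (pair-subst σ p _) ⟩
    ⟪ subst σ p ∣ (λ v → ⟪ subst σ q ∣ (λ u → f (v ++ u)) ⟫) ⟫ ∎
    where open ≡-Reasoning

  σ⁺σ⁻-letter : ∀ l f → ⟪ σ⁻ l ∣ (λ m → ⟪ substWord σ⁺ m ∣ f ⟫) ⟫ ≡ f (l ∷ [])
  σ⁺σ⁻-letter false f = lemma (f (false ∷ [])) (f (true ∷ []))
    where
    lemma : ∀ a b → + 1 * (+ 1 * a + (+ 1 * b + + 0)) + (- + 1 * + 1 * (+ 1 * b + + 0) + + 0) ≡ a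
    lemma = solve-∀
  σ⁺σ⁻-letter true f = lemma (f (true ∷ []))
    where
    lemma : ∀ b → + 1 * (+ 1 * b + + 0) + + 0 ≡ b
    lemma = solve-∀

  σ⁺σ⁻-word : ∀ v f → ⟪ substWord σ⁻ v ∣ (λ u → ⟪ substWord σ⁺ u ∣ f ⟫) ⟫ ≡ f v
  σ⁺σ⁻-word [] f = trans (pair-one (λ u → ⟪ substWord σ⁺ u ∣ f ⟫)) (pair-one f)
  σ⁺σ⁻-word (l ∷ v) f = begin
    ⟪ σ⁻ l ⊗ substWord σ⁻ v ∣ (λ u → ⟪ substWord σ⁺ u ∣ f ⟫) ⟫
      ≡⟨ pair-⊗ (σ⁻ l) _ _ ⟩
    ⟪ σ⁻ l ∣ (λ m → ⟪ substWord σ⁻ v ∣ (λ u → ⟪ substWord σ⁺ (m ++ u) ∣ f ⟫) ⟫) ⟫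
      ≡⟨ pair-cong (σ⁻ l) (λ m → pair-cong (substWord σ⁻ v) (λ u → pair-substWord-++ σ⁺ m u f)) ⟩
    ⟪ σ⁻ l ∣ (λ m → ⟪ substWord σ⁻ v ∣ (λ u → ⟪ substWord σ⁺ m ∣ (λ m₁ → ⟪ substWord σ⁺ u ∣ (λ m′ → f (m₁ ++ m′)) ⟫) ⟫) ⟫) ⟫
      ≡⟨ pair-cong (σ⁻ l) (λ m → pair-swap (substWord σ⁻ v) (substWord σ⁺ m) _) ⟩
    ⟪ σ⁻ l ∣ (λ m → ⟪ substWord σ⁺ m ∣ (λ m₁ → ⟪ substWord σ⁻ v ∣ (λ u → ⟪ substWord σ⁺ u ∣ (λ m′ → f (m₁ ++ m′)) ⟫) ⟫) ⟫) ⟫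
      ≡⟨ pair-cong (σ⁻ l) (λ m → pair-cong (substWord σ⁺ m) (λ m₁ → σ⁺σ⁻-word v (λ m′ → f (m₁ ++ m′)))) ⟩
    ⟪ σ⁻ l ∣ (λ m → ⟪ substWord σ⁺ m ∣ (λ m₁ → f (m₁ ++ v)) ⟫) ⟫
      ≡⟨ σ⁺σ⁻-letter l (λ m₁ → f (m₁ ++ v)) ⟩
    f (l ∷ v) ∎
    where open ≡-Reasoning

  pair-σ⁺σ⁻ : ∀ p f → ⟪ subst σ⁺ (subst σ⁻ p) ∣ f ⟫ ≡ ⟪ p ∣ f ⟫
  pair-σ⁺σ⁻ p f = begin
    ⟪ subst σ⁺ (subst σ⁻ p) ∣ f ⟫
      ≡⟨ pair-subst σ⁺ (subst σ⁻ p) f ⟩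
    ⟪ subst σ⁻ p ∣ (λ u → ⟪ substWord σ⁺ u ∣ f ⟫) ⟫
      ≡⟨ pair-subst σ⁻ p _ ⟩
    ⟪ p ∣ (λ v → ⟪ substWord σ⁻ v ∣ (λ u → ⟪ substWord σ⁺ u ∣ f ⟫) ⟫) ⟫
      ≡⟨ pair-cong p (λ v → σ⁺σ⁻-word v f) ⟩
    ⟪ p ∣ f ⟫ ∎
    where open ≡-Reasoning

  pair-local : ∀ p q f →
    ⟪ subst σ⁺ (subst σ⁻ p ⊖ (subst σ⁻ q ⊗ (varA ⊕ varB))) ∣ f ⟫ ≡
    ⟪ p ∣ f ⟫ - ⟪ q ∣ (λ v → f (v ∷ʳ false) + + 2 * f (v ∷ʳ true)) ⟫
  pair-local p q f = begin
    ⟪ subst σ⁺ (subst σ⁻ p ⊖ (subst σ⁻ q ⊗ (varA ⊕ varB))) ∣ f ⟫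
      ≡⟨ pair-subst σ⁺ (subst σ⁻ p ⊖ (subst σ⁻ q ⊗ (varA ⊕ varB))) f ⟩
    ⟪ subst σ⁻ p ⊖ (subst σ⁻ q ⊗ (varA ⊕ varB)) ∣ f⁺ ⟫
      ≡⟨ pair-⊖ (subst σ⁻ p) _ f⁺ ⟩
    ⟪ subst σ⁻ p ∣ f⁺ ⟫ - ⟪ subst σ⁻ q ⊗ (varA ⊕ varB) ∣ f⁺ ⟫
      ≡⟨ cong₂ _-_ (sym (pair-subst σ⁺ (subst σ⁻ p) f)) (sym (pair-subst σ⁺ (subst σ⁻ q ⊗ (varA ⊕ varB)) f)) ⟩
    ⟪ subst σ⁺ (subst σ⁻ p) ∣ f ⟫ - ⟪ subst σ⁺ (subst σ⁻ q ⊗ (varA ⊕ varB)) ∣ f ⟫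
      ≡⟨ cong₂ _-_ (pair-σ⁺σ⁻ p f) (pair-subst-⊗ σ⁺ (subst σ⁻ q) (varA ⊕ varB) f) ⟩
    ⟪ p ∣ f ⟫ - ⟪ subst σ⁺ (subst σ⁻ q) ∣ (λ v → ⟪ subst σ⁺ (varA ⊕ varB) ∣ (λ u → f (v ++ u)) ⟫) ⟫
      ≡⟨ cong (_-_ ⟪ p ∣ f ⟫) (trans (pair-σ⁺σ⁻ q _) (pair-cong q (λ v → σ⁺[a+b] (λ u → f (v ++ u))))) ⟩
    ⟪ p ∣ f ⟫ - ⟪ q ∣ (λ v → f (v ∷ʳ false) + + 2 * f (v ∷ʳ true)) ⟫ ∎
    where
    open ≡-Reasoning
    f⁺ : Word → ℤ
    f⁺ v = ⟪ substWord σ⁺ v ∣ f ⟫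
    σ⁺[a+b] : ∀ g → ⟪ subst σ⁺ (varA ⊕ varB) ∣ g ⟫ ≡ g (false ∷ []) + + 2 * g (true ∷ [])
    σ⁺[a+b] g = lemma (g (false ∷ [])) (g (true ∷ []))
      where
      lemma : ∀ a b → + 1 * a + (+ 1 * b + (+ 1 * b + + 0)) ≡ a + + 2 * b
      lemma = solve-∀

  δ : Word → Word → ℤ
  δ w v = if v ==w w then + 1 else + 0

  coeff-pair : ∀ p w → coeff p w ≡ ⟪ p ∣ δ w ⟫
  coeff-pair [] w = refl
  coeff-pair ((c , v) ∷ p) w = cong₂ _+_ (term (v ==w w)) (coeff-pair p w)
    where
    term : ∀ b → (if b then c else + 0) ≡ c * (if b then + 1 else + 0)
    term true = sym (*-identityʳ c)
    term false = sym (*-zeroʳ c)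

  sumMasks : ℕ → (Word → ℤ) → ℤ
  sumMasks zero F = F []
  sumMasks (suc k) F = sumMasks k (λ S → F (false ∷ S)) + sumMasks k (λ S → F (true ∷ S))

  sumMasks-cong : ∀ k {F G} → (∀ S → length S ≡ k → F S ≡ G S) → sumMasks k F ≡ sumMasks k G
  sumMasks-cong zero F≗G = F≗G [] refl
  sumMasks-cong (suc k) F≗G = cong₂ _+_
    (sumMasks-cong k (λ S eq → F≗G (false ∷ S) (cong suc eq)))
    (sumMasks-cong k (λ S eq → F≗G (true ∷ S) (cong suc eq)))

  sumMasks-- : ∀ k F G → sumMasks k (λ S → F S - G S) ≡ sumMasks k F - sumMasks k G
  sumMasks-- zero F G = refl
  sumMasks-- (suc k) F G = trans
    (cong₂ _+_ (sumMasks-- k (λ S → F (false ∷ S)) (λ S → G (false ∷ S)))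
               (sumMasks-- k (λ S → F (true ∷ S)) (λ S → G (true ∷ S))))
    (lemma (sumMasks k (λ S → F (false ∷ S))) (sumMasks k (λ S → G (false ∷ S)))
           (sumMasks k (λ S → F (true ∷ S))) (sumMasks k (λ S → G (true ∷ S))))
    where
    lemma : ∀ a b c d → (a - b) + (c - d) ≡ (a + c) - (b + d)
    lemma = solve-∀

  sumMasks-∷ʳ : ∀ k F → sumMasks (suc k) F ≡ sumMasks k (λ u → F (u ∷ʳ false) + F (u ∷ʳ true))
  sumMasks-∷ʳ zero F = refl
  sumMasks-∷ʳ (suc k) F =
    cong₂ _+_ (sumMasks-∷ʳ k (λ S → F (false ∷ S))) (sumMasks-∷ʳ k (λ S → F (true ∷ S)))

  pair-tabulate : ∀ k (g : Word → ℤ) (e : Word → Word) f →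
    ⟪ map (λ S → (g S , e S)) (allMasks k) ∣ f ⟫ ≡ sumMasks k (λ S → g S * f (e S))
  pair-tabulate zero g e f = +-identityʳ _
  pair-tabulate (suc k) g e f = begin
    ⟪ map h (map (false ∷_) M ++ map (true ∷_) M) ∣ f ⟫
      ≡⟨ cong ⟪_∣ f ⟫ (map-++ h (map (false ∷_) M) (map (true ∷_) M)) ⟩
    ⟪ map h (map (false ∷_) M) ++ map h (map (true ∷_) M) ∣ f ⟫
      ≡⟨ pair-++ (map h (map (false ∷_) M)) _ f ⟩
    ⟪ map h (map (false ∷_) M) ∣ f ⟫ + ⟪ map h (map (true ∷_) M) ∣ f ⟫
      ≡⟨ cong₂ _+_ (cong ⟪_∣ f ⟫ (sym (map-∘ M))) (cong ⟪_∣ f ⟫ (sym (map-∘ M))) ⟩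
    ⟪ map (λ S → (g (false ∷ S) , e (false ∷ S))) M ∣ f ⟫ + ⟪ map (λ S → (g (true ∷ S) , e (true ∷ S))) M ∣ f ⟫
      ≡⟨ cong₂ _+_ (pair-tabulate k _ _ f) (pair-tabulate k _ _ f) ⟩
    sumMasks (suc k) (λ S → g S * f (e S)) ∎
    where
    open ≡-Reasoning
    M = allMasks k
    h = λ S → (g S , e S)

  pair-Υ : ∀ R f → ⟪ Υ R ∣ f ⟫ ≡ sumMasks (height R ∸ 1) (λ S → + α R S * f S)
  pair-Υ R f = pair-tabulate (height R ∸ 1) (λ S → + α R S) (λ S → S) f

  local-flag-identity : ∀ k (RQ RP R∂ R₁ : RawRanked) →
    height RQ ≡ suc (suc k) → height RP ≡ suc (suc k) → height R∂ ≡ suc k → height R₁ ≡ suc (suc k) →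
    (∀ u → length u ≡ k → α RQ (u ∷ʳ false) ≡ α RP (u ∷ʳ false)) →
    (∀ u → length u ≡ k → α RQ (u ∷ʳ true) ≡ α RP (u ∷ʳ true) ℕ.+ α R∂ u) →
    (∀ u l → length u ≡ k → α R₁ (u ∷ʳ l) ≡ α R∂ u) →
    ∀ w → coeff (subst σ⁺ (Ψ RQ ⊖ (Ψ R∂ ⊗ (varA ⊕ varB)))) w ≡ coeff (Υ RP ⊖ Υ R₁) w
  local-flag-identity k RQ RP R∂ R₁ hQ hP h∂ h₁ αQ-false αQ-true α₁ w = begin
    coeff (subst σ⁺ (Ψ RQ ⊖ (Ψ R∂ ⊗ (varA ⊕ varB)))) w
      ≡⟨ coeff-pair (subst σ⁺ (Ψ RQ ⊖ (Ψ R∂ ⊗ (varA ⊕ varB)))) w ⟩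
    ⟪ subst σ⁺ (Ψ RQ ⊖ (Ψ R∂ ⊗ (varA ⊕ varB))) ∣ f ⟫
      ≡⟨ pair-local (Υ RQ) (Υ R∂) f ⟩
    ⟪ Υ RQ ∣ f ⟫ - ⟪ Υ R∂ ∣ f₂ ⟫
      ≡⟨ cong₂ _-_ (trans (pair-Υ RQ f) (sums RQ hQ f))
                   (trans (pair-Υ R∂ f₂) (cong (λ m → sumMasks (m ∸ 1) (λ u → + α R∂ u * f₂ u)) h∂)) ⟩
    sumMasks k (λ u → term RQ (u ∷ʳ false) + term RQ (u ∷ʳ true)) - sumMasks k (λ u → + α R∂ u * f₂ u)
      ≡⟨ sym (sumMasks-- k (λ u → term RQ (u ∷ʳ false) + term RQ (u ∷ʳ true)) (λ u → + α R∂ u * f₂ u)) ⟩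
    sumMasks k (λ u → (term RQ (u ∷ʳ false) + term RQ (u ∷ʳ true)) - + α R∂ u * f₂ u)
      ≡⟨ sumMasks-cong k pointwise ⟩
    sumMasks k (λ u → (term RP (u ∷ʳ false) + term RP (u ∷ʳ true)) - (term R₁ (u ∷ʳ false) + term R₁ (u ∷ʳ true)))
      ≡⟨ sumMasks-- k (λ u → term RP (u ∷ʳ false) + term RP (u ∷ʳ true)) (λ u → term R₁ (u ∷ʳ false) + term R₁ (u ∷ʳ true)) ⟩
    sumMasks k (λ u → term RP (u ∷ʳ false) + term RP (u ∷ʳ true)) - sumMasks k (λ u → term R₁ (u ∷ʳ false) + term R₁ (u ∷ʳ true))
      ≡⟨ sym (cong₂ _-_ (trans (pair-Υ RP f) (sums RP hP f)) (trans (pair-Υ R₁ f) (sums R₁ h₁ f))) ⟩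
    ⟪ Υ RP ∣ f ⟫ - ⟪ Υ R₁ ∣ f ⟫
      ≡⟨ sym (pair-⊖ (Υ RP) (Υ R₁) f) ⟩
    ⟪ Υ RP ⊖ Υ R₁ ∣ f ⟫
      ≡⟨ sym (coeff-pair (Υ RP ⊖ Υ R₁) w) ⟩
    coeff (Υ RP ⊖ Υ R₁) w ∎
    where
    open ≡-Reasoning
    f f₂ : Word → ℤ
    f = δ w
    f₂ v = f (v ∷ʳ false) + + 2 * f (v ∷ʳ true)
    term : RawRanked → Word → ℤ
    term R S = + α R S * f S
    sums : ∀ R → height R ≡ suc (suc k) → ∀ g →
      sumMasks (height R ∸ 1) (λ S → + α R S * g S) ≡
      sumMasks k (λ u → + α R (u ∷ʳ false) * g (u ∷ʳ false) + + α R (u ∷ʳ true) * g (u ∷ʳ true))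
    sums R h g = trans (cong (λ m → sumMasks (m ∸ 1) (λ S → + α R S * g S)) h) (sumMasks-∷ʳ k (λ S → + α R S * g S))
    pointwise : ∀ u → length u ≡ k →
      (term RQ (u ∷ʳ false) + term RQ (u ∷ʳ true)) - + α R∂ u * f₂ u ≡
      (term RP (u ∷ʳ false) + term RP (u ∷ʳ true)) - (term R₁ (u ∷ʳ false) + term R₁ (u ∷ʳ true))
    pointwise u len
      rewrite αQ-false u len | αQ-true u len | α₁ u false len | α₁ u true len | pos-+ (α RP (u ∷ʳ true)) (α R∂ u)
      = lemma (+ α RP (u ∷ʳ false)) (+ α RP (u ∷ʳ true)) (+ α R∂ u) (f (u ∷ʳ false)) (f (u ∷ʳ true))
      where
      lemma : ∀ p q d x y → (p * x + (q + d) * y) - d * (x + + 2 * y) ≡ (p * x + q * y) - (d * x + d * y)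
      lemma = solve-∀

module Counting where
  open import Data.Nat using (_+_)
  open import Data.Nat.Properties using (+-identityʳ; +-commutativeSemigroup)
  open import Algebra.Properties.CommutativeSemigroup +-commutativeSemigroup using () renaming (interchange to +-interchange)

  module _ {X : Set} where

    count : List X → (List X → List X → Bool) → ℕ
    count [] Φ = if Φ [] [] then 1 else 0
    count (y ∷ R) Φ = count R (λ T F → Φ T (y ∷ F)) + count R (λ T F → Φ (y ∷ T) F)

    count-masks : ∀ R Φ → length (filterᵇ (λ m → Φ (selT R m) (selF R m)) (allMasks (length R))) ≡ count R Φ
    count-masks [] Φ with Φ [] []
    ... | true = refl
    ... | false = refl
    count-masks (y ∷ R) Φ = begin
      length (filterᵇ f (map (false ∷_) M ++ map (true ∷_) M))
        ≡⟨ length-filterᵇ-++ f (map (false ∷_) M) (map (true ∷_) M) ⟩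
      length (filterᵇ f (map (false ∷_) M)) + length (filterᵇ f (map (true ∷_) M))
        ≡⟨ cong₂ _+_ (length-filter-map (false ∷_)) (length-filter-map (true ∷_)) ⟩
      length (filterᵇ (λ m → Φ (selT R m) (y ∷ selF R m)) M) + length (filterᵇ (λ m → Φ (y ∷ selT R m) (selF R m)) M)
        ≡⟨ cong₂ _+_ (count-masks R (λ T F → Φ T (y ∷ F))) (count-masks R (λ T F → Φ (y ∷ T) F)) ⟩
      count (y ∷ R) Φ ∎
      where
      open ≡-Reasoning
      M = allMasks (length R)
      f = λ m → Φ (selT (y ∷ R) m) (selF (y ∷ R) m)
      length-filter-map : ∀ g → length (filterᵇ f (map g M)) ≡ length (filterᵇ (λ m → f (g m)) M)
      length-filter-map g = trans (cong length (filterᵇ-map f g M)) (length-map g (filterᵇ (λ m → f (g m)) M))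

    IsSplit : List X → List X → List X → Set
    IsSplit R T F = (T ⊆ R) × (F ⊆ R) × (∀ {a} → a ∈ R → (a ∈ T) ⊎ (a ∈ F))

    count-cong : ∀ R {Φ Ψ} → (∀ T F → IsSplit R T F → Φ T F ≡ Ψ T F) → count R Φ ≡ count R Ψ
    count-cong [] Φ≡Ψ rewrite Φ≡Ψ [] [] ((λ ()) , (λ ()) , (λ ())) = refl
    count-cong (y ∷ R) Φ≡Ψ = cong₂ _+_
      (count-cong R (λ T F (T⊆R , F⊆R , cover) →
        Φ≡Ψ T (y ∷ F) (there ∘ T⊆R , ∷⁺ʳ y F⊆R , λ { (here p) → inj₂ (here p) ; (there i) → Sum.map₂ there (cover i) })))
      (count-cong R (λ T F (T⊆R , F⊆R , cover) →
        Φ≡Ψ (y ∷ T) F (∷⁺ʳ y T⊆R , there ∘ F⊆R , λ { (here p) → inj₁ (here p) ; (there i) → Sum.map₁ there (cover i) })))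

    count-false : ∀ R → count R (λ _ _ → false) ≡ 0
    count-false [] = refl
    count-false (y ∷ R) = cong₂ _+_ (count-false R) (count-false R)

    count-zero : ∀ R {Φ} → (∀ T F → IsSplit R T F → Φ T F ≡ false) → count R Φ ≡ 0
    count-zero R Φ≡false = trans (count-cong R Φ≡false) (count-false R)

  count-map : ∀ {X Y : Set} (g : X → Y) R Φ → count (map g R) Φ ≡ count R (λ T F → Φ (map g T) (map g F))
  count-map g [] Φ = refl
  count-map g (y ∷ R) Φ = cong₂ _+_ (count-map g R _) (count-map g R _)

  module _ {X : Set} where

    RespectsSets : (List X → List X → Bool) → Set
    RespectsSets Φ = ∀ {T T′ F F′} → T ⊆ T′ → T′ ⊆ T → F ⊆ F′ → F′ ⊆ F → Φ T F ≡ Φ T′ F′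

    RespectsSets-keep : ∀ {Φ} y → RespectsSets Φ → RespectsSets (λ T F → Φ (y ∷ T) F)
    RespectsSets-keep y resp T⊆ ⊇T F⊆ ⊇F = resp (∷⁺ʳ y T⊆) (∷⁺ʳ y ⊇T) F⊆ ⊇F

    RespectsSets-drop : ∀ {Φ} y → RespectsSets Φ → RespectsSets (λ T F → Φ T (y ∷ F))
    RespectsSets-drop y resp T⊆ ⊇T F⊆ ⊇F = resp T⊆ ⊇T (∷⁺ʳ y F⊆) (∷⁺ʳ y ⊇F)

    private
      swap-⊆ : ∀ (a b : X) xs → a ∷ b ∷ xs ⊆ b ∷ a ∷ xs
      swap-⊆ a b xs (here p) = there (here p)
      swap-⊆ a b xs (there (here p)) = here p
      swap-⊆ a b xs (there (there i)) = there (there i)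

    swap-kept : ∀ {Φ} → RespectsSets Φ → ∀ a b T F → Φ (a ∷ b ∷ T) F ≡ Φ (b ∷ a ∷ T) F
    swap-kept resp a b T F = resp (swap-⊆ a b T) (swap-⊆ b a T) ⊆-refl ⊆-refl

    swap-dropped : ∀ {Φ} → RespectsSets Φ → ∀ a b T F → Φ T (a ∷ b ∷ F) ≡ Φ T (b ∷ a ∷ F)
    swap-dropped resp a b T F = resp ⊆-refl ⊆-refl (swap-⊆ a b F) (swap-⊆ b a F)

    module _ (_≟_ : DecidableEquality X) where

      ≢⇒distinct : ∀ {a b} → a ≢ b → not (does (a ≟ b)) ≡ true
      ≢⇒distinct {a} {b} a≢b = cong not (dec-false (a ≟ b) a≢b)

      distinct⇒≢ : ∀ {a b} → not (does (a ≟ b)) ≡ true → a ≢ b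
      distinct⇒≢ {a} {b} distinct a≡b = true≢false (trans (sym (dec-true (a ≟ b) a≡b)) (not-true distinct))

      remove : X → List X → List X
      remove x = filterᵇ (λ y → not (does (y ≟ x)))

      remove-∉ : ∀ x xs → All (λ y → ¬ x ≡ y) xs → remove x xs ≡ xs
      remove-∉ x [] [] = refl
      remove-∉ x (y ∷ xs) (x≢y ∷ x∉xs) with y ≟ x
      ... | yes y≡x = ⊥-elim (x≢y (sym y≡x))
      ... | no _ = cong (y ∷_) (remove-∉ x xs x∉xs)

      count-remove : ∀ {Φ} → RespectsSets Φ → ∀ {L x} → Unique L → x ∈ L →
        count L Φ ≡ count (remove x L) (λ T F → Φ T (x ∷ F)) + count (remove x L) (λ T F → Φ (x ∷ T) F)
      count-remove {Φ} resp {a ∷ L} {x} (a∉L ∷ unique) x∈ with a ≟ x | x∈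
      ... | yes refl | _ rewrite remove-∉ a L a∉L = refl
      ... | no a≢x | here x≡a = ⊥-elim (a≢x (sym x≡a))
      ... | no a≢x | there x∈L = begin
        count L (λ T F → Φ T (a ∷ F)) + count L (λ T F → Φ (a ∷ T) F)
          ≡⟨ cong₂ _+_ (count-remove (RespectsSets-drop a resp) unique x∈L) (count-remove (RespectsSets-keep a resp) unique x∈L) ⟩
        (count R (λ T F → Φ T (a ∷ x ∷ F)) + count R (λ T F → Φ (x ∷ T) (a ∷ F))) +
        (count R (λ T F → Φ (a ∷ T) (x ∷ F)) + count R (λ T F → Φ (a ∷ x ∷ T) F))
          ≡⟨ +-interchange (count R (λ T F → Φ T (a ∷ x ∷ F))) (count R (λ T F → Φ (x ∷ T) (a ∷ F)))
                           (count R (λ T F → Φ (a ∷ T) (x ∷ F))) (count R (λ T F → Φ (a ∷ x ∷ T) F)) ⟩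
        (count R (λ T F → Φ T (a ∷ x ∷ F)) + count R (λ T F → Φ (a ∷ T) (x ∷ F))) +
        (count R (λ T F → Φ (x ∷ T) (a ∷ F)) + count R (λ T F → Φ (a ∷ x ∷ T) F))
          ≡⟨ cong₂ _+_ (cong (_+ count R (λ T F → Φ (a ∷ T) (x ∷ F))) (count-cong R (λ T F _ → swap-dropped resp a x T F)))
                       (cong (count R (λ T F → Φ (x ∷ T) (a ∷ F)) +_) (count-cong R (λ T F _ → swap-kept resp a x T F))) ⟩
        (count R (λ T F → Φ T (x ∷ a ∷ F)) + count R (λ T F → Φ (a ∷ T) (x ∷ F))) +
        (count R (λ T F → Φ (x ∷ T) (a ∷ F)) + count R (λ T F → Φ (x ∷ a ∷ T) F)) ∎
        where
        open ≡-Reasoning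
        R = remove x L

    Irrelevant : X → (List X → List X → Bool) → Set
    Irrelevant a Φ = (∀ T F → a ∈ T → Φ T F ≡ false) × (∀ T F → Φ T (a ∷ F) ≡ Φ T F)

    count-irrelevant : ∀ {Φ} → RespectsSets Φ → ∀ L {p q : X → Bool} → (∀ a → q a ≡ true → p a ≡ true) →
      (∀ a → p a ≡ true → q a ≡ false → Irrelevant a Φ) → count (filterᵇ p L) Φ ≡ count (filterᵇ q L) Φ
    count-irrelevant resp [] q⇒p irr = refl
    count-irrelevant {Φ} resp (a ∷ L) {p} {q} q⇒p irr with p a in pa | q a in qa
    ... | true | true = cong₂ _+_
      (count-irrelevant (RespectsSets-drop a resp) L q⇒p
        (λ b pb qb → let (b∉T , b∈F) = irr b pb qb in
          (λ T F → b∉T T (a ∷ F)) , (λ T F → trans (swap-dropped resp a b T F) (b∈F T (a ∷ F)))))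
      (count-irrelevant (RespectsSets-keep a resp) L q⇒p
        (λ b pb qb → let (b∉T , b∈F) = irr b pb qb in
          (λ T F b∈T → b∉T (a ∷ T) F (there b∈T)) , (λ T F → b∈F (a ∷ T) F)))
    ... | true | false = begin
      count (filterᵇ p L) (λ T F → Φ T (a ∷ F)) + count (filterᵇ p L) (λ T F → Φ (a ∷ T) F)
        ≡⟨ cong₂ _+_ (count-cong (filterᵇ p L) (λ T F _ → a∈F T F))
                     (count-zero (filterᵇ p L) (λ T F _ → a∉T (a ∷ T) F (here refl))) ⟩
      count (filterᵇ p L) Φ + 0
        ≡⟨ +-identityʳ _ ⟩
      count (filterᵇ p L) Φ
        ≡⟨ count-irrelevant resp L q⇒p irr ⟩
      count (filterᵇ q L) Φ ∎
      where
      open ≡-Reasoning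
      a∉T = proj₁ (irr a pa qa)
      a∈F = proj₂ (irr a pa qa)
    ... | false | true with () ← trans (sym pa) (q⇒p a qa)
    ... | false | false = count-irrelevant resp L q⇒p irr

  maxChainSplit : {A : Set} → (A → A → Bool) → List A → List A → Bool
  maxChainSplit le T F = isChain le T ∧ all (λ y → any (λ c → not (comparable le y c)) T) F

  #maxChains-count : ∀ {A : Set} (le : A → A → Bool) R → #maxChains le R ≡ count R (maxChainSplit le)
  #maxChains-count le R = count-masks R (maxChainSplit le)

  module _ {A B : Set} (g : A → B) {leA : A → A → Bool} {leB : B → B → Bool}
           (embedding : ∀ a b → leB (g a) (g b) ≡ leA a b) where

    private
      comparable-map : ∀ a b → comparable leB (g a) (g b) ≡ comparable leA a b
      comparable-map a b rewrite embedding a b | embedding b a = refl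

      all-map : ∀ {f f′} → (∀ a → f (g a) ≡ f′ a) → ∀ T → all f (map g T) ≡ all f′ T
      all-map e [] = refl
      all-map e (t ∷ T) = cong₂ _∧_ (e t) (all-map e T)

      any-map : ∀ {f f′} → (∀ a → f (g a) ≡ f′ a) → ∀ T → any f (map g T) ≡ any f′ T
      any-map e [] = refl
      any-map e (t ∷ T) = cong₂ _∨_ (e t) (any-map e T)

      isChain-map : ∀ T → isChain leB (map g T) ≡ isChain leA T
      isChain-map [] = refl
      isChain-map (t ∷ T) = cong₂ _∧_ (all-map (comparable-map t) T) (isChain-map T)

    count-embedding : ∀ R → count (map g R) (maxChainSplit leB) ≡ count R (maxChainSplit leA)
    count-embedding R = trans (count-map g R (maxChainSplit leB)) (count-cong R (λ T F _ →
      cong₂ _∧_ (isChain-map T) (all-map (λ z → any-map (λ c → cong not (comparable-map z c)) T) F)))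

  module Chains {A : Set} (le : A → A → Bool) (le-refl : ∀ a → le a a ≡ true) where

    Incomparable : A → A → Set
    Incomparable a b = comparable le a b ≡ false

    comparable-refl : ∀ a → comparable le a a ≡ true
    comparable-refl a = ∨-trueˡ _ (le-refl a)

    comparable-sym : ∀ a b → comparable le a b ≡ comparable le b a
    comparable-sym a b with le a b | le b a
    ... | true | true = refl
    ... | true | false = refl
    ... | false | true = refl
    ... | false | false = refl

    isChain⁻ : ∀ T → isChain le T ≡ true → ∀ {a b} → a ∈ T → b ∈ T → comparable le a b ≡ true
    isChain⁻ (t ∷ T) ch (here refl) (here refl) = comparable-refl t
    isChain⁻ (t ∷ T) ch (here refl) (there j) = all⁻ _ T (proj₁ (∧-true⁻ _ ch)) j
    isChain⁻ (t ∷ T) ch {a} (there i) (here refl) = trans (comparable-sym a t) (all⁻ _ T (proj₁ (∧-true⁻ _ ch)) i)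
    isChain⁻ (t ∷ T) ch (there i) (there j) = isChain⁻ T (proj₂ (∧-true⁻ (all (comparable le t) T) ch)) i j

    isChain⁺ : ∀ T → (∀ {a b} → a ∈ T → b ∈ T → comparable le a b ≡ true) → isChain le T ≡ true
    isChain⁺ [] _ = refl
    isChain⁺ (t ∷ T) h = ∧-true⁺ (all⁺ _ T (λ j → h (here refl) (there j))) (isChain⁺ T (λ i j → h (there i) (there j)))

    Blocked : List A → A → Set
    Blocked T z = Σ A λ c → (c ∈ T) × Incomparable z c

    maxChainSplit⁻ : ∀ T F → maxChainSplit le T F ≡ true →
      (isChain le T ≡ true) × (∀ {z} → z ∈ F → Blocked T z)
    maxChainSplit⁻ T F e with ∧-true⁻ (isChain le T) e
    ... | ch , blocked = ch , λ z∈F → let (c , c∈T , q) = any⁻ _ T (all⁻ _ F blocked z∈F) in c , c∈T , not-true q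

    maxChainSplit⁺ : ∀ T F → isChain le T ≡ true → (∀ {z} → z ∈ F → Blocked T z) → maxChainSplit le T F ≡ true
    maxChainSplit⁺ T F ch blocked = ∧-true⁺ ch (all⁺ _ F (λ z∈F →
      let (c , c∈T , q) = blocked z∈F in any⁺ _ T c∈T (cong not q)))

    maxChainSplit-resp : RespectsSets (maxChainSplit le)
    maxChainSplit-resp T⊆T′ T′⊆T F⊆F′ F′⊆F = bool-ext (transport T′⊆T T⊆T′ F′⊆F) (transport T⊆T′ T′⊆T F⊆F′)
      where
      transport : ∀ {T T′ F F′} → T′ ⊆ T → T ⊆ T′ → F′ ⊆ F → maxChainSplit le T F ≡ true → maxChainSplit le T′ F′ ≡ true
      transport {T} {T′} {F} {F′} T′⊆T T⊆T′ F′⊆F e with maxChainSplit⁻ T F e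
      ... | ch , blocked = maxChainSplit⁺ T′ F′ (isChain⁺ T′ (λ i j → isChain⁻ T ch (T′⊆T i) (T′⊆T j)))
        (λ z∈F′ → let (c , c∈T , q) = blocked (F′⊆F z∈F′) in c , T⊆T′ c∈T , q)

    module _ {R : List A} {t : A} (t-comparable : ∀ {a} → a ∈ R → comparable le t a ≡ true) where

      count-cone-kept : count R (λ T F → maxChainSplit le (t ∷ T) F) ≡ count R (maxChainSplit le)
      count-cone-kept = count-cong R λ T F (T⊆R , F⊆R , _) → bool-ext (forth T F F⊆R) (back T F T⊆R)
        where
        forth : ∀ T F → F ⊆ R → maxChainSplit le (t ∷ T) F ≡ true → maxChainSplit le T F ≡ true
        forth T F F⊆R e with maxChainSplit⁻ (t ∷ T) F e
        ... | ch , blocked = maxChainSplit⁺ T F (isChain⁺ T (λ i j → isChain⁻ (t ∷ T) ch (there i) (there j))) λ z∈F →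
          case blocked z∈F of λ where
            (c , there c∈T , q) → c , c∈T , q
            (c , here refl , q) → ⊥-elim (true≢false (trans (sym (trans (comparable-sym _ c) (t-comparable (F⊆R z∈F)))) q))
        back : ∀ T F → T ⊆ R → maxChainSplit le T F ≡ true → maxChainSplit le (t ∷ T) F ≡ true
        back T F T⊆R e with maxChainSplit⁻ T F e
        ... | ch , blocked = maxChainSplit⁺ (t ∷ T) F (isChain⁺ (t ∷ T) pairs) λ z∈F →
          let (c , c∈T , q) = blocked z∈F in c , there c∈T , q
          where
          pairs : ∀ {a b} → a ∈ t ∷ T → b ∈ t ∷ T → comparable le a b ≡ true
          pairs (here refl) (here refl) = comparable-refl t
          pairs (here refl) (there j) = t-comparable (T⊆R j)
          pairs {a} (there i) (here refl) = trans (comparable-sym a t) (t-comparable (T⊆R i))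
          pairs (there i) (there j) = isChain⁻ T ch i j

      count-cone : count (t ∷ R) (maxChainSplit le) ≡ count R (maxChainSplit le)
      count-cone = cong₂ _+_ (count-zero R λ T F (T⊆R , _) → false-if λ e →
          let (c , c∈T , q) = proj₂ (maxChainSplit⁻ T (t ∷ F) e) (here refl) in
          true≢false (trans (sym (t-comparable (T⊆R c∈T))) q))
        count-cone-kept

    count-drop-blocked : ∀ R x → (∀ T F → IsSplit R T F → maxChainSplit le T F ≡ true → Blocked T x) →
      count R (λ T F → maxChainSplit le T (x ∷ F)) ≡ count R (maxChainSplit le)
    count-drop-blocked R x blocks = count-cong R λ T F split → bool-ext
      (λ e → let (ch , blocked) = maxChainSplit⁻ T (x ∷ F) e in maxChainSplit⁺ T F ch (blocked ∘ there))
      (λ e → let (ch , blocked) = maxChainSplit⁻ T F e in maxChainSplit⁺ T (x ∷ F) ch λ where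
        (here refl) → blocks T F split e
        (there z∈F) → blocked z∈F)

    incomparable-irrelevant : ∀ {x a} → Incomparable x a → Irrelevant a (λ T F → maxChainSplit le (x ∷ T) F)
    incomparable-irrelevant {x} {a} x∥a = kept , dropped
      where
      kept : ∀ T F → a ∈ T → maxChainSplit le (x ∷ T) F ≡ false
      kept T F a∈T = false-if λ e →
        true≢false (trans (sym (isChain⁻ (x ∷ T) (proj₁ (maxChainSplit⁻ (x ∷ T) F e)) (here refl) (there a∈T))) x∥a)
      dropped : ∀ T F → maxChainSplit le (x ∷ T) (a ∷ F) ≡ maxChainSplit le (x ∷ T) F
      dropped T F = bool-ext
        (λ e → let (ch , blocked) = maxChainSplit⁻ (x ∷ T) (a ∷ F) e in maxChainSplit⁺ (x ∷ T) F ch (blocked ∘ there))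
        (λ e → let (ch , blocked) = maxChainSplit⁻ (x ∷ T) F e in maxChainSplit⁺ (x ∷ T) (a ∷ F) ch λ where
          (here refl) → x , here refl , trans (comparable-sym a x) x∥a
          (there z∈F) → blocked z∈F)

open Pairing using (local-flag-identity)
open Counting

-- An adjoined top is either not selected, or selected and then on every maximal chain.
α-adjoinTop : ∀ R → (∀ a → le R a a ≡ true) → ∀ h S → α (adjoinTop R h) S ≡ α R S
α-adjoinTop R le-refl h S = begin
  #maxChains le′ (filterᵇ f′ (nothing ∷ map just E))
    ≡⟨ #maxChains-count le′ (filterᵇ f′ (nothing ∷ map just E)) ⟩
  count (filterᵇ f′ (nothing ∷ map just E)) (maxChainSplit le′)
    ≡⟨ top-invisible (inS h S) refl ⟩
  count (map just (filterᵇ f E)) (maxChainSplit le′)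
    ≡⟨ count-embedding just (λ _ _ → refl) (filterᵇ f E) ⟩
  count (filterᵇ f E) (maxChainSplit (le R))
    ≡⟨ sym (#maxChains-count (le R) (filterᵇ f E)) ⟩
  α R S ∎
  where
  open ≡-Reasoning
  le′ = le (adjoinTop R h)
  f′ = λ y → inS (rk (adjoinTop R h) y) S
  f = λ y → inS (rk R y) S
  E = elems R
  le′-refl : ∀ a → le′ a a ≡ true
  le′-refl (just a) = le-refl a
  le′-refl nothing = refl
  top-comparable : ∀ a → comparable le′ nothing a ≡ true
  top-comparable (just a) = refl
  top-comparable nothing = refl
  top-invisible : ∀ b → inS h S ≡ b →
    count (filterᵇ f′ (nothing ∷ map just E)) (maxChainSplit le′) ≡ count (map just (filterᵇ f E)) (maxChainSplit le′)
  top-invisible false unselected =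
    cong (λ L → count L (maxChainSplit le′)) (trans (filterᵇ-reject f′ {nothing} (map just E) unselected) (filterᵇ-map f′ just E))
  top-invisible true selected = trans
    (cong (λ L → count L (maxChainSplit le′))
      (trans (filterᵇ-accept f′ {nothing} (map just E) selected) (cong (nothing ∷_) (filterᵇ-map f′ just E))))
    (Chains.count-cone le′ le′-refl {map just (filterᵇ f E)} {nothing} (λ {a} _ → top-comparable a))

length-∷ʳ : ∀ {A : Set} (u : List A) l → length (u ∷ʳ l) ≡ suc (length u)
length-∷ʳ [] l = refl
length-∷ʳ (s ∷ u) l = cong suc (length-∷ʳ u l)

inS-beyond : ∀ r S → length S < r → inS r S ≡ false
inS-beyond (suc zero) [] _ = refl
inS-beyond (suc zero) (s ∷ S) (s≤s ())
inS-beyond (suc (suc r)) [] _ = refl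
inS-beyond (suc (suc r)) (s ∷ S) (s≤s len<r) = inS-beyond (suc r) S len<r

inS-∷ʳ : ∀ r u l → r ≤ length u → inS r (u ∷ʳ l) ≡ inS r u
inS-∷ʳ zero u l _ = refl
inS-∷ʳ (suc zero) (s ∷ u) l _ = refl
inS-∷ʳ (suc (suc r)) (s ∷ u) l (s≤s r≤len) = inS-∷ʳ (suc r) u l r≤len

inS-last : ∀ u l → inS (suc (length u)) (u ∷ʳ l) ≡ l
inS-last [] l = refl
inS-last (s ∷ u) l = inS-last u l

2≰1 : ¬ 2 ≤ 1
2≰1 (s≤s ())

module Order (Q : BoundedPoset) where
  private module Q = BoundedPoset Q

  Elt : Set
  Elt = Fin Q.n

  _⊑_ _⊏_ : Elt → Elt → Set
  a ⊑ b = (a Q.≤ᵖ b) ≡ true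
  a ⊏ b = _<ᵖ_ Q a b ≡ true

  ⊏⁻ : ∀ {a b} → a ⊏ b → (a ⊑ b) × (a ≢ b)
  ⊏⁻ {a} a⊏b with ∧-true⁻ (a Q.≤ᵖ _) a⊏b
  ... | a⊑b , distinct = a⊑b , distinct⇒≢ _≟_ distinct

  ⊏⁺ : ∀ {a b} → a ⊑ b → a ≢ b → a ⊏ b
  ⊏⁺ a⊑b a≢b = ∧-true⁺ a⊑b (≢⇒distinct _≟_ a≢b)

  ⊏-irrefl : ∀ a → _<ᵖ_ Q a a ≡ false
  ⊏-irrefl a = false-if λ a⊏a → proj₂ (⊏⁻ a⊏a) refl

  ⊑-trans : ∀ {a b c} → a ⊑ b → b ⊑ c → a ⊑ c
  ⊑-trans = Q.transᵖ _ _ _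

  ⊑-⊏-trans : ∀ {a b c} → a ⊑ b → b ⊏ c → a ⊏ c
  ⊑-⊏-trans a⊑b b⊏c with ⊏⁻ b⊏c
  ... | b⊑c , b≢c = ⊏⁺ (⊑-trans a⊑b b⊑c) λ { refl → b≢c (Q.antisymᵖ _ _ b⊑c a⊑b) }

  ⊏-⊑-trans : ∀ {a b c} → a ⊏ b → b ⊑ c → a ⊏ c
  ⊏-⊑-trans a⊏b b⊑c with ⊏⁻ a⊏b
  ... | a⊑b , a≢b = ⊏⁺ (⊑-trans a⊑b b⊑c) λ { refl → a≢b (Q.antisymᵖ _ _ a⊑b b⊑c) }

  ⊏-trans : ∀ {a b c} → a ⊏ b → b ⊏ c → a ⊏ c
  ⊏-trans a⊏b b⊏c = ⊏-⊑-trans a⊏b (proj₁ (⊏⁻ b⊏c))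

  strictlyBetween : Elt → Elt → Elt → Bool
  strictlyBetween a b z = (_<ᵖ_ Q a z) ∧ (_<ᵖ_ Q z b)

  cover-or-between : ∀ {a b} → a ⊏ b → (_⋖_ Q a b) ⊎ Σ Elt λ z → (a ⊏ z) × (z ⊏ b)
  cover-or-between {a} {b} a⊏b with any (strictlyBetween a b) (allFin Q.n) in found
  ... | false = inj₁ (a⊏b , λ (z , a⊏z , z⊏b) →
                 true≢false (trans (sym (any⁺ _ (allFin Q.n) (∈-allFin z) (∧-true⁺ a⊏z z⊏b))) found))
  ... | true with any⁻ _ (allFin Q.n) found
  ... | z , _ , between = inj₂ (z , ∧-true⁻ (_<ᵖ_ Q a z) between)

  module Graded (ρ : Elt → ℕ) (rank : IsRankFunction Q ρ) where

    #between : Elt → Elt → ℕ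
    #between a b = length (filterᵇ (strictlyBetween a b) (allFin Q.n))

    ⊏-descend : ∀ k {a b} → #between a b < k → a ⊏ b → (ρ a < ρ b) × Σ Elt λ w → (a ⊑ w) × (_⋖_ Q w b)
    ⊏-descend (suc k) {a} {b} bound a⊏b with cover-or-between a⊏b
    ... | inj₁ a⋖b = ≡-subst (ρ a <_) (sym (proj₂ rank a b a⋖b)) ≤-refl , a , Q.reflᵖ a , a⋖b
    ... | inj₂ (z , a⊏z , z⊏b) with ⊏-descend k (≤-trans fewer-left (≤-pred bound)) a⊏z
                                  | ⊏-descend k (≤-trans fewer-right (≤-pred bound)) z⊏b
      where
      z∈ab : strictlyBetween a b z ≡ true
      z∈ab = ∧-true⁺ a⊏z z⊏b
      fewer-left : #between a z < #between a b
      fewer-left = length-filterᵇ-< (allFin Q.n)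
        (λ y e → let (a⊏y , y⊏z) = ∧-true⁻ (_<ᵖ_ Q a y) e in ∧-true⁺ a⊏y (⊏-trans y⊏z z⊏b))
        (∈-allFin z) z∈ab (trans (cong (_<ᵖ_ Q a z ∧_) (⊏-irrefl z)) (∧-zeroʳ _))
      fewer-right : #between z b < #between a b
      fewer-right = length-filterᵇ-< (allFin Q.n)
        (λ y e → let (z⊏y , y⊏b) = ∧-true⁻ (_<ᵖ_ Q z y) e in ∧-true⁺ (⊏-trans a⊏z z⊏y) y⊏b)
        (∈-allFin z) z∈ab (cong (_∧ _<ᵖ_ Q z b) (⊏-irrefl z))
    ... | ρa<ρz , _ | ρz<ρb , w , z⊑w , w⋖b = <-trans ρa<ρz ρz<ρb , w , ⊑-trans (proj₁ (⊏⁻ a⊏z)) z⊑w , w⋖b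

    ρ-mono : ∀ {a b} → a ⊏ b → ρ a < ρ b
    ρ-mono {a} {b} a⊏b = proj₁ (⊏-descend (suc (#between a b)) ≤-refl a⊏b)

    cover-below : ∀ {a b} → a ⊏ b → Σ Elt λ w → (a ⊑ w) × (_⋖_ Q w b)
    cover-below {a} {b} a⊏b = proj₂ (⊏-descend (suc (#between a b)) ≤-refl a⊏b)

    module _ (eulerian : IsEulerian Q ρ) where

      diamond : ∀ {w x t} → _⋖_ Q w x → _⋖_ Q x t → Σ Elt λ z → (w ⊏ z) × (z ⊏ t) × (z ≢ x)
      diamond {w} {x} {t} w⋖x x⋖t with any (λ z → strictlyBetween w t z ∧ not (does (z ≟ x))) (allFin Q.n) in found
      ... | true with any⁻ _ (allFin Q.n) found
      ...   | z , _ , e with ∧-true⁻ (strictlyBetween w t z) e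
      ...     | between , z≠x = z , proj₁ (∧-true⁻ (_<ᵖ_ Q w z) between) , proj₂ (∧-true⁻ (_<ᵖ_ Q w z) between) ,
                                 distinct⇒≢ _≟_ z≠x
      diamond {w} {x} {t} w⋖x x⋖t | false = ⊥-elim (parity-clash (isEven Q (ρ w)) refl)
        where
        w⊏t : w ⊏ t
        w⊏t = ⊏-trans (proj₁ w⋖x) (proj₁ x⋖t)
        only-x : ∀ z → w ⊏ z → z ⊏ t → z ≡ x
        only-x z w⊏z z⊏t with z ≟ x
        ... | yes z≡x = z≡x
        ... | no z≢x = ⊥-elim (true≢false (trans (sym (any⁺ _ (allFin Q.n) (∈-allFin z)
                          (∧-true⁺ (∧-true⁺ w⊏z z⊏t) (≢⇒distinct _≟_ z≢x)))) found))
        parity : Elt → Bool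
        parity z = isEven Q (ρ z)
        parity-t : parity t ≡ parity w
        parity-t = trans (cong (isEven Q) (trans (proj₂ rank x t x⋖t) (cong suc (proj₂ rank w x w⋖x)))) (not-involutive _)
        #[_] : (Bool → Bool) → ℕ
        #[ h ] = length (filterᵇ (λ z → (w Q.≤ᵖ z) ∧ (z Q.≤ᵖ t) ∧ h (parity z)) (allFin Q.n))
        at-least-two : ∀ h → h (parity w) ≡ true → 2 ≤ #[ h ]
        at-least-two h hw = length-filterᵇ-≥2 _ (allFin Q.n) (∈-allFin w) (∈-allFin t) (proj₂ (⊏⁻ w⊏t))
          (∧-true⁺ (Q.reflᵖ w) (∧-true⁺ (proj₁ (⊏⁻ w⊏t)) hw))
          (∧-true⁺ (proj₁ (⊏⁻ w⊏t)) (∧-true⁺ (Q.reflᵖ t) (trans (cong h parity-t) hw)))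
        at-most-one : ∀ h → h (parity w) ≡ false → #[ h ] ≤ 1
        at-most-one h hw = length-filterᵇ-≤1 _ x (allFin⁺ Q.n) λ z e →
          let (w⊑z , rest) = ∧-true⁻ (w Q.≤ᵖ z) e ; (z⊑t , hz) = ∧-true⁻ (z Q.≤ᵖ t) rest in
          case z ≟ w of λ where
            (yes refl) → ⊥-elim (true≢false (trans (sym hz) hw))
            (no z≢w) → case z ≟ t of λ where
              (yes refl) → ⊥-elim (true≢false (trans (sym hz) (trans (cong h parity-t) hw)))
              (no z≢t) → only-x z (⊏⁺ w⊑z (z≢w ∘ sym)) (⊏⁺ z⊑t z≢t)
        -- If [w,t] were the chain w ⋖ x ⋖ t, its even- and odd-rank elements would number 2 and 1.
        parity-clash : ∀ b → parity w ≡ b → ⊥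
        parity-clash true pw =
          2≰1 (≤-trans (at-least-two id pw) (≤-trans (≤-reflexive (eulerian w t w⊏t)) (at-most-one not (cong not pw))))
        parity-clash false pw =
          2≰1 (≤-trans (at-least-two not (cong not pw)) (≤-trans (≤-reflexive (sym (eulerian w t w⊏t))) (at-most-one id pw)))

module NearEulerian (Q : BoundedPoset) (ρ : Fin (n Q) → ℕ) (rank : IsRankFunction Q ρ) (eulerian : IsEulerian Q ρ)
                    (x : Fin (n Q)) (coatom : IsCoatom Q x) (x≢𝟘 : x ≢ 𝟘 Q) where
  open Order Q
  open Graded ρ rank
  private module Q = BoundedPoset Q

  ρ𝟙 : ρ Q.𝟙 ≡ suc (ρ x)
  ρ𝟙 = proj₂ rank x Q.𝟙 coatom

  ρx-suc : ρ x ≡ suc (ρ x ∸ 1)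
  ρx-suc with ρ x | ρ-mono (⊏⁺ (Q.𝟘-min x) (x≢𝟘 ∘ sym))
  ... | suc r | _ = refl

  above-coatom : ∀ {c} → x ⊏ c → c ≡ Q.𝟙
  above-coatom {c} x⊏c with c ≟ Q.𝟙
  ... | yes c≡𝟙 = c≡𝟙
  ... | no c≢𝟙 = ⊥-elim (proj₂ coatom (c , x⊏c , ⊏⁺ (Q.𝟙-max c) c≢𝟙))

  diamond-below : ∀ {y} → y ⊏ x → Σ Elt λ z → (y ⊏ z) × (ρ z ≡ ρ x) × (z ≢ x)
  diamond-below y⊏x with cover-below y⊏x
  ... | w , y⊑w , w⋖x with diamond eulerian w⋖x coatom
  ... | z , w⊏z , z⊏𝟙 , z≢x = z , ⊑-⊏-trans y⊑w w⊏z , ρz≡ρx , z≢x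
    where
    ρx≡ : ρ x ≡ suc (ρ w)
    ρx≡ = proj₂ rank w x w⋖x
    ρz≡ρx : ρ z ≡ ρ x
    ρz≡ρx = ≤-antisym (≤-pred (≡-subst (ρ z <_) ρ𝟙 (ρ-mono z⊏𝟙)))
                      (≡-subst (_≤ ρ z) (sym ρx≡) (ρ-mono w⊏z))

  open Chains Q._≤ᵖ_ Q.reflᵖ

  chain-top : ∀ T → (∀ {c} → c ∈ T → c ⊏ x) → isChain Q._≤ᵖ_ T ≡ true →
    Σ Elt λ y → (y ⊏ x) × (∀ {c} → c ∈ T → c ⊑ y) × ((y ≡ Q.𝟘) ⊎ (y ∈ T))
  chain-top [] _ _ = Q.𝟘 , ⊏⁺ (Q.𝟘-min x) (x≢𝟘 ∘ sym) , (λ ()) , inj₁ refl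
  chain-top (t ∷ T) below ch with ∧-true⁻ (all (comparable Q._≤ᵖ_ t) T) ch
  ... | t-comparable , ch-T with chain-top T (below ∘ there) ch-T
  ...   | y , y⊏x , bound , y-origin with ∨-true⁻ (t Q.≤ᵖ y) (comparable-to-top y-origin)
    where
    comparable-to-top : (y ≡ Q.𝟘) ⊎ (y ∈ T) → comparable Q._≤ᵖ_ t y ≡ true
    comparable-to-top (inj₁ refl) = ∨-trueʳ (t Q.≤ᵖ Q.𝟘) (Q.𝟘-min t)
    comparable-to-top (inj₂ y∈T) = all⁻ _ T t-comparable y∈T
  ...     | inj₁ t⊑y = y , y⊏x , (λ { (here refl) → t⊑y ; (there c∈T) → bound c∈T }) , Sum.map₂ there y-origin
  ...     | inj₂ y⊑t =
    t , below (here refl) , (λ { (here refl) → Q.reflᵖ t ; (there c∈T) → ⊑-trans (bound c∈T) y⊑t }) , inj₂ (here refl)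

  module Selection (u : Word) (len-u : suc (length u) ≡ ρ x) where

    selected : Bool → Elt → Bool
    selected l a = inS (ρ a) (u ∷ʳ l)

    selected-x : ∀ l → selected l x ≡ l
    selected-x l = trans (cong (λ r → inS r (u ∷ʳ l)) (sym len-u)) (inS-last u l)

    selected-𝟙 : ∀ l → selected l Q.𝟙 ≡ false
    selected-𝟙 l = inS-beyond (ρ Q.𝟙) (u ∷ʳ l)
      (≡-subst₂ _<_ (sym (trans (length-∷ʳ u l) len-u)) (sym ρ𝟙) (n<1+n (ρ x)))

    selected-below : ∀ l {a} → a ⊏ x → selected l a ≡ inS (ρ a) u
    selected-below l {a} a⊏x = inS-∷ʳ (ρ a) u l (≤-pred (≡-subst (ρ a <_) (sym len-u) (ρ-mono a⊏x)))

    boundary-refl : ∀ a → le (boundary Q ρ x) a a ≡ true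
    boundary-refl (just a) = Q.reflᵖ a
    boundary-refl nothing = refl

    below-selected : List Elt
    below-selected = filterᵇ (λ a → inS (ρ a) u) (elems (below Q ρ x))

    α-boundary : α (boundary Q ρ x) u ≡ count below-selected (maxChainSplit Q._≤ᵖ_)
    α-boundary = trans (α-adjoinTop (below Q ρ x) Q.reflᵖ (ρ x) u) (#maxChains-count Q._≤ᵖ_ below-selected)

    α-P₁-boundary : ∀ l → α (P₁ (boundary Q ρ x)) (u ∷ʳ l) ≡ α (boundary Q ρ x) u
    α-P₁-boundary l = begin
      α (P₁ (boundary Q ρ x)) (u ∷ʳ l)
        ≡⟨ α-adjoinTop (boundary Q ρ x) boundary-refl (suc (ρ x)) (u ∷ʳ l) ⟩
      α (boundary Q ρ x) (u ∷ʳ l)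
        ≡⟨ α-adjoinTop (below Q ρ x) Q.reflᵖ (ρ x) (u ∷ʳ l) ⟩
      α (below Q ρ x) (u ∷ʳ l)
        ≡⟨ cong (#maxChains Q._≤ᵖ_) (filterᵇ-cong (elems (below Q ρ x)) λ a∈ →
             selected-below l (proj₂ (∈-filterᵇ⁻ _ (allFin Q.n) a∈))) ⟩
      α (below Q ρ x) u
        ≡⟨ sym (α-adjoinTop (below Q ρ x) Q.reflᵖ (ρ x) u) ⟩
      α (boundary Q ρ x) u ∎
      where open ≡-Reasoning

    Φ : List Elt → List Elt → Bool
    Φ = maxChainSplit Q._≤ᵖ_

    L : List Elt
    L = allFin Q.n

    P-selected : Bool → List Elt
    P-selected l = filterᵇ (selected l) (remove _≟_ x L)

    ∈P-selected⁻ : ∀ {l a} → a ∈ P-selected l → (a ≢ x) × (selected l a ≡ true)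
    ∈P-selected⁻ a∈ with ∈-filterᵇ⁻ _ (remove _≟_ x L) a∈
    ... | a∈L-x , sel-a = distinct⇒≢ _≟_ (proj₂ (∈-filterᵇ⁻ _ L a∈L-x)) , sel-a

    ∈P-selected⁺ : ∀ {l a} → a ≢ x → selected l a ≡ true → a ∈ P-selected l
    ∈P-selected⁺ {a = a} a≢x sel-a = ∈-filterᵇ⁺ _ _ (∈-filterᵇ⁺ _ L (∈-allFin a) (≢⇒distinct _≟_ a≢x)) sel-a

    α-Q-false : α (toRaw Q ρ) (u ∷ʳ false) ≡ α (removeElem Q ρ x) (u ∷ʳ false)
    α-Q-false = cong (#maxChains Q._≤ᵖ_) (trans (filterᵇ-cong L (λ {a} _ → x-unselected a))
                                                (sym (filterᵇ-filterᵇ (selected false) _ L)))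
      where
      x-unselected : ∀ a → selected false a ≡ not (does (a ≟ x)) ∧ selected false a
      x-unselected a with a ≟ x
      ... | yes refl = selected-x false
      ... | no _ = refl

    maximal-chains-block-x : ∀ T F → IsSplit (P-selected true) T F → Φ T F ≡ true → Blocked T x
    maximal-chains-block-x T F (T⊆ , _ , cover) mc with any (λ c → not (comparable Q._≤ᵖ_ x c)) T in found
    ... | true = let (c , c∈T , q) = any⁻ _ T found in c , c∈T , not-true q
    ... | false = ⊥-elim absurd
      where
      comparable-x : ∀ {c} → c ∈ T → comparable Q._≤ᵖ_ x c ≡ true
      comparable-x c∈T = true-if λ x∥c → true≢false (trans (sym (any⁺ _ T c∈T (cong not x∥c))) found)
      below-x : ∀ {c} → c ∈ T → c ⊏ x
      below-x c∈T with ∈P-selected⁻ (T⊆ c∈T) | ∨-true⁻ (x Q.≤ᵖ _) (comparable-x c∈T)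
      ... | c≢x , _ | inj₂ c⊑x = ⊏⁺ c⊑x c≢x
      ... | c≢x , sel-c | inj₁ x⊑c with above-coatom (⊏⁺ x⊑c (c≢x ∘ sym))
      ...   | refl = ⊥-elim (true≢false (trans (sym sel-c) (selected-𝟙 true)))
      absurd : ⊥
      absurd with chain-top T below-x (proj₁ (maxChainSplit⁻ T F mc))
      ... | y , y⊏x , bound , _ with diamond-below y⊏x
      ... | z , y⊏z , ρz≡ρx , z≢x with cover (∈P-selected⁺ z≢x (trans (cong (λ r → inS r (u ∷ʳ true)) ρz≡ρx) (selected-x true)))
      ... | inj₁ z∈T = <-irrefl ρz≡ρx (ρ-mono (below-x z∈T))
      ... | inj₂ z∈F with proj₂ (maxChainSplit⁻ T F mc) z∈F
      ... | c , c∈T , z∥c = true≢false (trans (sym (∨-trueʳ (z Q.≤ᵖ c) (⊑-trans (bound c∈T) (proj₁ (⊏⁻ y⊏z))))) z∥c)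

    chains-through-x : count (P-selected true) (λ T F → Φ (x ∷ T) F) ≡ count below-selected Φ
    chains-through-x = begin
      count (P-selected true) Φₓ
        ≡⟨ cong (λ R → count R Φₓ) (filterᵇ-filterᵇ (selected true) _ L) ⟩
      count (filterᵇ (λ a → not (does (a ≟ x)) ∧ selected true a) L) Φₓ
        ≡⟨ count-irrelevant (RespectsSets-keep x maxChainSplit-resp) L below⇒selected incomparable ⟩
      count (filterᵇ (λ a → (_<ᵖ_ Q a x) ∧ inS (ρ a) u) L) Φₓ
        ≡⟨ cong (λ R → count R Φₓ) (sym (filterᵇ-filterᵇ (λ a → inS (ρ a) u) _ L)) ⟩
      count below-selected Φₓ
        ≡⟨ count-cone-kept (λ a∈below → ∨-trueʳ (x Q.≤ᵖ _) (proj₁ (⊏⁻ (∈below-selected⁻ a∈below)))) ⟩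
      count below-selected Φ ∎
      where
      open ≡-Reasoning
      Φₓ = λ T F → Φ (x ∷ T) F
      ∈below-selected⁻ : ∀ {a} → a ∈ below-selected → a ⊏ x
      ∈below-selected⁻ a∈below = proj₂ (∈-filterᵇ⁻ _ L (proj₁ (∈-filterᵇ⁻ _ (elems (below Q ρ x)) a∈below)))
      below⇒selected : ∀ a → ((_<ᵖ_ Q a x) ∧ inS (ρ a) u) ≡ true → (not (does (a ≟ x)) ∧ selected true a) ≡ true
      below⇒selected a e with ∧-true⁻ (_<ᵖ_ Q a x) e
      ... | a⊏x , sel-a = ∧-true⁺ (≢⇒distinct _≟_ (proj₂ (⊏⁻ a⊏x))) (trans (selected-below true a⊏x) sel-a)
      incomparable : ∀ a → (not (does (a ≟ x)) ∧ selected true a) ≡ true → ((_<ᵖ_ Q a x) ∧ inS (ρ a) u) ≡ false →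
        Irrelevant a Φₓ
      incomparable a e not-below with ∧-true⁻ (not (does (a ≟ x))) e
      ... | distinct , sel-a = incomparable-irrelevant (false-if λ comparable-xa →
        case ∨-true⁻ (x Q.≤ᵖ a) comparable-xa of λ where
          (inj₁ x⊑a) → case above-coatom (⊏⁺ x⊑a (distinct⇒≢ _≟_ distinct ∘ sym)) of λ where
            refl → true≢false (trans (sym sel-a) (selected-𝟙 true))
          (inj₂ a⊑x) → let a⊏x = ⊏⁺ a⊑x (distinct⇒≢ _≟_ distinct) in
            true≢false (trans (sym (∧-true⁺ a⊏x (trans (sym (selected-below true a⊏x)) sel-a))) not-below))

    α-Q-true : α (toRaw Q ρ) (u ∷ʳ true) ≡ α (removeElem Q ρ x) (u ∷ʳ true) ℕ.+ α (boundary Q ρ x) u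
    α-Q-true = begin
      #maxChains Q._≤ᵖ_ Q-selected
        ≡⟨ #maxChains-count Q._≤ᵖ_ Q-selected ⟩
      count Q-selected Φ
        ≡⟨ count-remove _≟_ maxChainSplit-resp (filter⁺ (T? ∘ selected true) (allFin⁺ Q.n))
                        (∈-filterᵇ⁺ _ L (∈-allFin x) (selected-x true)) ⟩
      count (remove _≟_ x Q-selected) (λ T F → Φ T (x ∷ F)) ℕ.+ count (remove _≟_ x Q-selected) (λ T F → Φ (x ∷ T) F)
        ≡⟨ cong (λ R → count R (λ T F → Φ T (x ∷ F)) ℕ.+ count R (λ T F → Φ (x ∷ T) F)) (filterᵇ-comm _ (selected true) L) ⟩
      count (P-selected true) (λ T F → Φ T (x ∷ F)) ℕ.+ count (P-selected true) (λ T F → Φ (x ∷ T) F)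
        ≡⟨ cong₂ ℕ._+_ (count-drop-blocked (P-selected true) x maximal-chains-block-x) chains-through-x ⟩
      count (P-selected true) Φ ℕ.+ count below-selected Φ
        ≡⟨ cong₂ ℕ._+_ (sym (#maxChains-count Q._≤ᵖ_ (P-selected true))) (sym α-boundary) ⟩
      α (removeElem Q ρ x) (u ∷ʳ true) ℕ.+ α (boundary Q ρ x) u ∎
      where
      open ≡-Reasoning
      Q-selected = filterᵇ (selected true) L

lemma4p14 : (Q : BoundedPoset) (ρ : Fin (n Q) → ℕ) → IsRankFunction Q ρ → IsEulerian Q ρ →
    (x : Fin (n Q)) → IsCoatom Q x → ¬ (x ≡ 𝟘 Q) →
    ∀ w → coeff (Υℓ Q ρ x) w ≡ coeff (Υ (removeElem Q ρ x) ⊖ Υ (P₁ (boundary Q ρ x))) w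
lemma4p14 Q ρ rank eulerian x coatom x≢𝟘 =
  local-flag-identity (ρ x ∸ 1) (toRaw Q ρ) (removeElem Q ρ x) (boundary Q ρ x) (P₁ (boundary Q ρ x))
    (trans ρ𝟙 (cong suc ρx-suc)) (trans ρ𝟙 (cong suc ρx-suc)) ρx-suc (cong suc ρx-suc)
    (λ u len → Selection.α-Q-false u (rank-of u len))
    (λ u len → Selection.α-Q-true u (rank-of u len))
    (λ u l len → Selection.α-P₁-boundary u (rank-of u len) l)
  where
  open NearEulerian Q ρ rank eulerian x coatom x≢𝟘
  rank-of : ∀ u → length u ≡ ρ x ∸ 1 → suc (length u) ≡ ρ x
  rank-of u len = trans (cong suc len) (sym ρx-suc)
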